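{- For every integer $j$, \[ \sum_{\lambda\in \mathcal{P}_{j}\cap \mathcal{D}}q^{|\lambda|}=\frac{q^{\binom{2j}{2}}}{\prod_{i\geq 1}(1-q^{2i})}. \]
   Context: The $2$-core of a partition is obtained by repeatedly removing dominoes (rim hooks of length $2$) whose removal leaves a Young diagram until none remain; it is well defined and is a staircase of size $\binom{2j}{2}=j(2j-1)$ for a unique integer $j$. $\mathcal{P}_j$ is the set of all partitions whose $2$-core has size $\binom{2j}{2}$, and $\mathcal{D}$ is the set of partitions with distinct parts. -}

module Defs where

open import Data.Nat using (ℕ; zero; suc; _+_; _<_; _≥_)
open import Data.Nat.Divisibility using (_∣_)
open import Data.Integer as ℤ using (ℤ; ∣_∣)
open import Data.List using (List; []; _∷_)
open import Data.Nat.ListAction using (sum)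
open import Data.List.Relation.Unary.All using (All)
open import Data.List.Relation.Unary.Linked using (Linked)
open import Data.List.Relation.Unary.Unique.Propositional using (Unique)
open import Data.Product using (Σ; ∃; _×_)
open import Data.Sum using (_⊎_)
open import Relation.Binary.PropositionalEquality using (_≡_; _≢_)
open import Relation.Binary.Construct.Closure.ReflexiveTransitive using (Star)
open import Relation.Nullary using (¬_)

IsPartition : List ℕ → Set
IsPartition λ′ = Linked _≥_ λ′ × All (0 <_) λ′

size : List ℕ → ℕ
size = sum

DistinctParts : List ℕ → Set
DistinctParts = Unique

row : List ℕ → ℕ → ℕ
row []       _       = 0
row (x ∷ xs) zero    = x
row (x ∷ xs) (suc i) = row xs i

-- μ is obtained from λ by removing a domino (rim hook of length 2) such that
-- the result is again a Young diagram:
--  * horizontal domino: two cells at the end of row i, or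
--  * vertical domino: the last cells of rows i and i+1 (same column, so the
--    two rows have equal length).
-- Requiring μ to be a partition is the condition "removal leaves a Young diagram".
RemoveDomino : List ℕ → List ℕ → Set
RemoveDomino λ′ μ =
  IsPartition μ ×
  ∃ λ i →
    ( (row μ i + 2 ≡ row λ′ i × (∀ k → k ≢ i → row μ k ≡ row λ′ k))
    ⊎ (row λ′ i ≡ row λ′ (suc i) ×
       row μ i + 1 ≡ row λ′ i ×
       row μ (suc i) + 1 ≡ row λ′ (suc i) ×
       (∀ k → k ≢ i → k ≢ suc i → row μ k ≡ row λ′ k)))

Is2CoreOf : List ℕ → List ℕ → Set
Is2CoreOf κ λ′ = Star RemoveDomino λ′ κ × (∀ ν → ¬ RemoveDomino κ ν)

-- binom(2j,2) = j(2j-1) for an integer j (always ≥ 0).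
binom2j2 : ℤ → ℕ
binom2j2 j = ∣ j ℤ.* (j ℤ.+ j ℤ.- ℤ.+ 1) ∣

InP : ℤ → List ℕ → Set
InP j λ′ = ∃ λ κ → Is2CoreOf κ λ′ × size κ ≡ binom2j2 j

-- Equal cardinality of two (finite) sets of lists, given as predicates:
-- an explicit bijection between {x | P x} and {y | Q y}.
-- (Stated on the underlying lists to avoid proof-relevance of the predicates.)
SameCard : (List ℕ → Set) → (List ℕ → Set) → Set
SameCard P Q =
  Σ (List ℕ → List ℕ) λ f → Σ (List ℕ → List ℕ) λ g →
    (∀ x → P x → Q (f x)) × (∀ y → Q y → P (g y)) ×
    (∀ x → P x → g (f x) ≡ x) × (∀ y → Q y → f (g y) ≡ y)

-- Coefficient of q^n on the left: partitions of n in 𝒫_j ∩ 𝒟.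
LHSCoeff : ℤ → ℕ → List ℕ → Set
LHSCoeff j n λ′ = IsPartition λ′ × InP j λ′ × DistinctParts λ′ × size λ′ ≡ n

-- Coefficient of q^n on the right: q^{binom(2j,2)} / ∏_{i≥1}(1-q^{2i})
-- = q^{binom(2j,2)} ∑_{μ with all parts even} q^{|μ|}.
RHSCoeff : ℤ → ℕ → List ℕ → Set
RHSCoeff j n μ = IsPartition μ × All (2 ∣_) μ × binom2j2 j + size μ ≡ n

-- A domino removal leaves the alternating count d(λ) = Σᵢ (−1)ⁱ [λᵢ odd] unchanged, and the partitions
-- without removable dominoes are exactly the staircases δₖ = (k, k−1, …, 1). Since d(δₖ) determines k,
-- and |δₖ| = binom(2j,2) precisely for the k with d(δₖ) = j, a partition lies in 𝒫ⱼ iff d(λ) = j.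
--
-- A partition λ with distinct parts is π + δ_ℓ for a partition π with ℓ parts, zeros allowed. Writing
-- the odd parts of π as 2u+1 and the even ones as 2v gives a pair (U, V) with o and e parts; d(λ) = d(δₖ)
-- for the charge k = e − o (o ≤ e) or o − e − 1 (o > e), and |λ| = |δ_{o+e}| + o + 2|U| + 2|V|, which is
-- |δₖ| + 2(o(e+1) + |U| + |V|).
--
-- Pairs (U, V) of charge k correspond to arbitrary partitions ν with |ν| = o(e+1) + |U| + |V|: put U to the
-- right of an o × (e+1) rectangle and the conjugate of V below it when o ≤ e, and V to the right of the
-- first e rows of an (e+1) × o rectangle with the conjugate of U below it otherwise. Doubling the parts
-- of ν gives the partitions of |λ| − binom(2j,2) into even parts.

module Submission where

open import Defs

open import Data.Bool using (true; false; if_then_else_)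
open import Data.Integer as ℤ using (ℤ; 0ℤ; 1ℤ; _-_)
open import Data.Integer.Properties using (abs-*)
open import Data.Integer.Tactic.RingSolver using () renaming (solve-∀ to ℤ-solve-∀)
open import Data.List using (List; []; _∷_; _++_; length; map; replicate; drop)
open import Data.List.Properties
  using (length-map; length-++; length-replicate; map-∘; map-id-local; ++-identityʳ)
open import Data.List.Relation.Binary.Permutation.Propositional using (_↭_; ↭-refl; ↭-sym; ↭-trans; prep)
open import Data.List.Relation.Binary.Permutation.Propositional.Properties
  using (shift; ↭-length) renaming (++-identityʳ to ↭-++-identityʳ)
open import Data.List.Relation.Unary.All as All using (All; []; _∷_)
open import Data.List.Relation.Unary.All.Properties using (map⁺; ++⁺; replicate⁺)
open import Data.List.Relation.Unary.AllPairs as AllPairs using (AllPairs; []; _∷_)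
open import Data.List.Relation.Unary.Linked as Linked using (Linked; []; [-]; _∷_)
open import Data.List.Relation.Unary.Linked.Properties using (Linked⇒AllPairs) renaming (map⁺ to Linked-map⁺)
import Data.Nat as ℕ
open import Data.Nat
  using (ℕ; zero; suc; _+_; _*_; _∸_; _≤_; _<_; _≥_; _>_; z≤n; s≤s; _≤?_; _<?_; _≤ᵇ_; _<ᵇ_; ⌊_/2⌋; parity)
open import Data.Nat.Divisibility using (_∣_; divides)
open import Data.Nat.Induction using (<-wellFounded)
open import Data.Nat.ListAction using (sum)
open import Data.Nat.ListAction.Properties using (sum-++; sum-↭)
open import Data.Nat.Properties
open import Algebra.Properties.CommutativeSemigroup +-commutativeSemigroup using (interchange; x∙yz≈y∙xz)
open import Data.Nat.Tactic.RingSolver using (solve-∀)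
open import Data.Parity.Base as ℙ using (Parity; 0ℙ; 1ℙ)
open import Data.Parity.Properties using (+-homo-+; suc-homo-⁻¹)
open import Data.Product using (∃-syntax; _×_; _,_; proj₁; proj₂; uncurry; map₁; map₂)
open import Data.Sum as Sum using (_⊎_; inj₁; inj₂)
open import Function using (_∘_; _on_; id)
open import Induction.WellFounded using (Acc; acc)
open import Level using (0ℓ)
open import Relation.Binary.Construct.Closure.ReflexiveTransitive using (Star; ε; _◅_; fold)
import Relation.Binary.Construct.On as On
open import Relation.Binary.Definitions using (tri<; tri≈; tri>)
open import Relation.Binary.PropositionalEquality
  using (_≡_; _≢_; refl; sym; trans; cong; cong₂; subst; subst₂; module ≡-Reasoning)
open import Relation.Nullary using (¬_; yes; no; contradiction)
open import Relation.Nullary.Reflects using (ofʸ; ofⁿ)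
open import Relation.Unary using (Pred; _∩_; _≐_)

-- Bijections between subsets

record _≅_ {A B : Set} (P : Pred A 0ℓ) (Q : Pred B 0ℓ) : Set where
  field
    to      : A → B
    from    : B → A
    to-∈    : ∀ {x} → P x → Q (to x)
    from-∈  : ∀ {y} → Q y → P (from y)
    from∘to : ∀ {x} → P x → from (to x) ≡ x
    to∘from : ∀ {y} → Q y → to (from y) ≡ y

open _≅_

infix 4 _≅_
infixr 9 _≅-∘_

_≅-∘_ : ∀ {A B C} {P : Pred A 0ℓ} {Q : Pred B 0ℓ} {R : Pred C 0ℓ} → Q ≅ R → P ≅ Q → P ≅ R
g ≅-∘ f = record
  { to      = to g ∘ to f
  ; from    = from f ∘ from g
  ; to-∈    = to-∈ g ∘ to-∈ f
  ; from-∈  = from-∈ f ∘ from-∈ g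
  ; from∘to = λ p → trans (cong (from f) (from∘to g (to-∈ f p))) (from∘to f p)
  ; to∘from = λ q → trans (cong (to g) (to∘from f (from-∈ g q))) (to∘from g q)
  }

restrict : ∀ {A B} {P R : Pred A 0ℓ} {Q S : Pred B 0ℓ} (e : P ≅ Q) →
           (∀ {x} → P x → R x → S (to e x)) → (∀ {x} → P x → S (to e x) → R x) →
           P ∩ R ≅ Q ∩ S
restrict {S = S} e R⇒S S⇒R = record
  { to      = to e
  ; from    = from e
  ; to-∈    = λ (p , r) → to-∈ e p , R⇒S p r
  ; from-∈  = λ (q , s) → from-∈ e q , S⇒R (from-∈ e q) (subst S (sym (to∘from e q)) s)
  ; from∘to = from∘to e ∘ proj₁
  ; to∘from = to∘from e ∘ proj₁
  }

≅-resp-≐ : ∀ {A B} {P P′ : Pred A 0ℓ} {Q Q′ : Pred B 0ℓ} → P ≐ P′ → Q ≐ Q′ → P′ ≅ Q′ → P ≅ Q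
≅-resp-≐ (P⊆P′ , P′⊆P) (Q⊆Q′ , Q′⊆Q) e = record
  { to      = to e
  ; from    = from e
  ; to-∈    = Q′⊆Q ∘ to-∈ e ∘ P⊆P′
  ; from-∈  = P′⊆P ∘ from-∈ e ∘ Q⊆Q′
  ; from∘to = from∘to e ∘ P⊆P′
  ; to∘from = to∘from e ∘ Q⊆Q′
  }

sameCard : {P Q : Pred (List ℕ) 0ℓ} → P ≅ Q → SameCard P Q
sameCard e = to e , from e , (λ _ → to-∈ e) , (λ _ → from-∈ e) , (λ _ → from∘to e) , (λ _ → to∘from e)

-- Halving and weakly decreasing lists

double : ℕ → ℕ
double n = n + n

double+1 : ℕ → ℕ
double+1 n = suc (double n)

parity-double : ∀ n → parity (double n) ≡ 0ℙ
parity-double zero    = refl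
parity-double (suc n) rewrite +-suc n n = parity-double n

parity-double+1 : ∀ n → parity (double+1 n) ≡ 1ℙ
parity-double+1 zero    = refl
parity-double+1 (suc n) rewrite +-suc n n = parity-double+1 n

⌊double/2⌋ : ∀ n → ⌊ double n /2⌋ ≡ n
⌊double/2⌋ n = sym (n≡⌊n+n/2⌋ n)

⌊double+1/2⌋ : ∀ n → ⌊ double+1 n /2⌋ ≡ n
⌊double+1/2⌋ zero    = refl
⌊double+1/2⌋ (suc n) rewrite +-suc n n = cong suc (⌊double+1/2⌋ n)

even⇒double : ∀ n → parity n ≡ 0ℙ → double ⌊ n /2⌋ ≡ n
even⇒double zero          _  = refl
even⇒double (suc zero)    ()
even⇒double (suc (suc n)) ev rewrite +-suc ⌊ n /2⌋ ⌊ n /2⌋ = cong (suc ∘ suc) (even⇒double n ev)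

odd⇒double+1 : ∀ n → parity n ≡ 1ℙ → double+1 ⌊ n /2⌋ ≡ n
odd⇒double+1 zero          ()
odd⇒double+1 (suc zero)    _  = refl
odd⇒double+1 (suc (suc n)) od rewrite +-suc ⌊ n /2⌋ ⌊ n /2⌋ = cong (suc ∘ suc) (odd⇒double+1 n od)

largest : List ℕ → ℕ
largest []      = 0
largest (x ∷ _) = x

Positive : Pred (List ℕ) 0ℓ
Positive = All (0 <_)

Desc : ℕ → List ℕ → Set
Desc b xs = Linked _≥_ (b ∷ xs)

data StrictDesc : ℕ → List ℕ → Set where
  []   : ∀ {b} → StrictDesc b []
  cons : ∀ {b x xs} → x < b → 0 < x → StrictDesc x xs → StrictDesc b (x ∷ xs)

Desc-weaken : ∀ {a b xs} → a ≤ b → Desc a xs → Desc b xs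
Desc-weaken a≤b [-]        = [-]
Desc-weaken a≤b (x≤a ∷ xs) = ≤-trans x≤a a≤b ∷ xs

Desc-largest : ∀ {b xs} → Desc b xs → largest xs ≤ b
Desc-largest [-]       = z≤n
Desc-largest (x≤b ∷ _) = x≤b

Desc-tight : ∀ {b xs} → Desc b xs → Desc (largest xs) xs
Desc-tight [-]      = [-]
Desc-tight (_ ∷ xs) = ≤-refl ∷ xs

Linked⇒Desc : ∀ {xs} → Linked _≥_ xs → Desc (largest xs) xs
Linked⇒Desc []        = [-]
Linked⇒Desc [-]       = ≤-refl ∷ [-]
Linked⇒Desc (le ∷ lk) = ≤-refl ∷ le ∷ lk

Desc⇒Linked : ∀ {b xs} → Desc b xs → Linked _≥_ xs
Desc⇒Linked = Linked.tail

Linked-∷ : ∀ {x xs} → largest xs ≤ x → Linked _≥_ xs → Linked _≥_ (x ∷ xs)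
Linked-∷ xs≤x lk = Desc-weaken xs≤x (Linked⇒Desc lk)

Positive-largest≤0 : ∀ {R} → Positive R → largest R ≤ 0 → R ≡ []
Positive-largest≤0 []        _   = refl
Positive-largest≤0 (() ∷ _) z≤n

Desc⇒All≤ : ∀ {b xs} → Desc b xs → All (_≤ b) xs
Desc⇒All≤ [-]        = []
Desc⇒All≤ (x≤b ∷ xs) = x≤b ∷ All.map (λ y≤x → ≤-trans y≤x x≤b) (Desc⇒All≤ xs)

DistinctPartition : Pred (List ℕ) 0ℓ
DistinctPartition = IsPartition ∩ DistinctParts

distinct⇒StrictDesc : ∀ {xs} → DistinctPartition xs → StrictDesc (suc (largest xs)) xs
distinct⇒StrictDesc ((lk , pos) , uniq) = go lk pos uniq
  where
    go : ∀ {xs} → Linked _≥_ xs → Positive xs → AllPairs _≢_ xs → StrictDesc (suc (largest xs)) xs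
    go []  _          _ = []
    go [-] (p ∷ [])   _ = cons ≤-refl p []
    go (y≤x ∷ lk) (p ∷ ps) ((x≢y ∷ _) ∷ uniq) with go lk ps uniq
    ... | cons _ q rest = cons ≤-refl p (cons (≤∧≢⇒< y≤x (x≢y ∘ sym)) q rest)

StrictDesc⇒Linked : ∀ {b xs} → StrictDesc b xs → Linked _>_ xs
StrictDesc⇒Linked []                        = []
StrictDesc⇒Linked (cons _ _ [])             = [-]
StrictDesc⇒Linked (cons _ _ (cons y<x p s)) = y<x ∷ StrictDesc⇒Linked (cons y<x p s)

StrictDesc⇒distinct : ∀ {b xs} → StrictDesc b xs → DistinctPartition xs
StrictDesc⇒distinct s =
  (Linked.map <⇒≤ lk , positive s) ,
  AllPairs.map (λ y<x x≡y → <⇒≢ y<x (sym x≡y)) (Linked⇒AllPairs (λ y<x z<y → <-trans z<y y<x) lk)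
  where
    lk = StrictDesc⇒Linked s
    positive : ∀ {b xs} → StrictDesc b xs → Positive xs
    positive []           = []
    positive (cons _ p s) = p ∷ positive s

-- Distinct partitions as partitions plus a staircase

staircase : ℕ → List ℕ
staircase zero    = []
staircase (suc k) = suc k ∷ staircase k

triangle : ℕ → ℕ
triangle k = sum (staircase k)

subStaircase : List ℕ → List ℕ
subStaircase []       = []
subStaircase (x ∷ xs) = x ∸ suc (length xs) ∷ subStaircase xs

addStaircase : List ℕ → List ℕ
addStaircase []       = []
addStaircase (y ∷ ys) = y + suc (length ys) ∷ addStaircase ys

length-subStaircase : ∀ xs → length (subStaircase xs) ≡ length xs
length-subStaircase []       = refl
length-subStaircase (x ∷ xs) = cong suc (length-subStaircase xs)

length-addStaircase : ∀ ys → length (addStaircase ys) ≡ length ys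
length-addStaircase []       = refl
length-addStaircase (y ∷ ys) = cong suc (length-addStaircase ys)

StrictDesc-length : ∀ {b xs} → StrictDesc b xs → 0 < b → length xs < b
StrictDesc-length []                  0<b = 0<b
StrictDesc-length (cons x<b 0<x rest) _   = ≤-trans (s≤s (StrictDesc-length rest 0<x)) x<b

addStaircase-subStaircase : ∀ {b xs} → StrictDesc b xs → addStaircase (subStaircase xs) ≡ xs
addStaircase-subStaircase [] = refl
addStaircase-subStaircase {xs = x ∷ xs} (cons _ 0<x rest) rewrite length-subStaircase xs =
  cong₂ _∷_ (m∸n+n≡m (StrictDesc-length rest 0<x)) (addStaircase-subStaircase rest)

subStaircase-addStaircase : ∀ ys → subStaircase (addStaircase ys) ≡ ys
subStaircase-addStaircase []       = refl
subStaircase-addStaircase (y ∷ ys) rewrite length-addStaircase ys =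
  cong₂ _∷_ (m+n∸n≡m y (suc (length ys))) (subStaircase-addStaircase ys)

Desc-subStaircase : ∀ {b xs} → StrictDesc b xs → Desc (b ∸ suc (length xs)) (subStaircase xs)
Desc-subStaircase []                       = [-]
Desc-subStaircase {xs = x ∷ xs} (cons x<b _ rest) =
  ∸-monoˡ-≤ (suc (suc (length xs))) x<b ∷ Desc-subStaircase rest

StrictDesc-addStaircase : ∀ {c ys} → Desc c ys → StrictDesc (c + suc (length ys)) (addStaircase ys)
StrictDesc-addStaircase [-] = []
StrictDesc-addStaircase {c} {y ∷ ys} (y≤c ∷ rest) =
  cons (subst (_≤ c + suc (suc ℓ)) (+-suc y (suc ℓ)) (+-monoˡ-≤ (suc (suc ℓ)) y≤c))
       (subst (0 <_) (sym (+-suc y ℓ)) (s≤s z≤n))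
       (StrictDesc-addStaircase rest)
  where ℓ = length ys

sum-addStaircase : ∀ ys → sum (addStaircase ys) ≡ sum ys + triangle (length ys)
sum-addStaircase []       = refl
sum-addStaircase (y ∷ ys) rewrite sum-addStaircase ys = shuffle y (length ys) (sum ys) (triangle (length ys))
  where
    shuffle : ∀ y ℓ s t → y + suc ℓ + (s + t) ≡ y + s + (suc ℓ + t)
    shuffle = solve-∀

distinct≅decreasing : DistinctPartition ≅ Linked _≥_
distinct≅decreasing = record
  { to      = subStaircase
  ; from    = addStaircase
  ; to-∈    = Desc⇒Linked ∘ Desc-subStaircase ∘ distinct⇒StrictDesc
  ; from-∈  = StrictDesc⇒distinct ∘ StrictDesc-addStaircase ∘ Linked⇒Desc
  ; from∘to = addStaircase-subStaircase ∘ distinct⇒StrictDesc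
  ; to∘from = λ {ys} _ → subStaircase-addStaircase ys
  }

-- Splitting a partition by parity

oddHalves : List ℕ → List ℕ
oddHalves []       = []
oddHalves (p ∷ ps) with parity p
... | 1ℙ = ⌊ p /2⌋ ∷ oddHalves ps
... | 0ℙ = oddHalves ps

evenHalves : List ℕ → List ℕ
evenHalves []       = []
evenHalves (p ∷ ps) with parity p
... | 1ℙ = evenHalves ps
... | 0ℙ = ⌊ p /2⌋ ∷ evenHalves ps

mergeHalves : List ℕ → List ℕ → List ℕ
mergeHalves []      V       = map double V
mergeHalves (u ∷ U) []      = map double+1 (u ∷ U)
mergeHalves (u ∷ U) (v ∷ V) =
  -- 2v ≤ 2u + 1 iff v ≤ u
  if v ≤ᵇ u then double+1 u ∷ mergeHalves U (v ∷ V) else double v ∷ mergeHalves (u ∷ U) V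

oddHalves-map-double : ∀ V → oddHalves (map double V) ≡ []
oddHalves-map-double []      = refl
oddHalves-map-double (v ∷ V) rewrite parity-double v = oddHalves-map-double V

evenHalves-map-double : ∀ V → evenHalves (map double V) ≡ V
evenHalves-map-double []      = refl
evenHalves-map-double (v ∷ V) rewrite parity-double v | ⌊double/2⌋ v = cong (v ∷_) (evenHalves-map-double V)

oddHalves-map-double+1 : ∀ U → oddHalves (map double+1 U) ≡ U
oddHalves-map-double+1 []      = refl
oddHalves-map-double+1 (u ∷ U) rewrite parity-double+1 u | ⌊double+1/2⌋ u =
  cong (u ∷_) (oddHalves-map-double+1 U)

evenHalves-map-double+1 : ∀ U → evenHalves (map double+1 U) ≡ []
evenHalves-map-double+1 []      = refl
evenHalves-map-double+1 (u ∷ U) rewrite parity-double+1 u = evenHalves-map-double+1 U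

oddHalves-mergeHalves : ∀ U V → oddHalves (mergeHalves U V) ≡ U
oddHalves-mergeHalves []      V       = oddHalves-map-double V
oddHalves-mergeHalves (u ∷ U) []      = oddHalves-map-double+1 (u ∷ U)
oddHalves-mergeHalves (u ∷ U) (v ∷ V)
  with v ≤ᵇ u | oddHalves-mergeHalves U (v ∷ V) | oddHalves-mergeHalves (u ∷ U) V
... | true  | ih | _  rewrite parity-double+1 u | ⌊double+1/2⌋ u = cong (u ∷_) ih
... | false | _  | ih rewrite parity-double v = ih

evenHalves-mergeHalves : ∀ U V → evenHalves (mergeHalves U V) ≡ V
evenHalves-mergeHalves []      V       = evenHalves-map-double V
evenHalves-mergeHalves (u ∷ U) []      = evenHalves-map-double+1 (u ∷ U)
evenHalves-mergeHalves (u ∷ U) (v ∷ V)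
  with v ≤ᵇ u | evenHalves-mergeHalves U (v ∷ V) | evenHalves-mergeHalves (u ∷ U) V
... | true  | ih | _  rewrite parity-double+1 u = ih
... | false | _  | ih rewrite parity-double v | ⌊double/2⌋ v = cong (v ∷_) ih

mergeHalves-[] : ∀ U → mergeHalves U [] ≡ map double+1 U
mergeHalves-[] []      = refl
mergeHalves-[] (u ∷ U) = refl

double≤double+1⇒≤ : ∀ {v u} → double v ≤ double+1 u → v ≤ u
double≤double+1⇒≤ {v} {u} le = subst₂ _≤_ (⌊double/2⌋ v) (⌊double+1/2⌋ u) (⌊n/2⌋-mono le)

double+1≤double⇒< : ∀ {u v} → double+1 u ≤ double v → u < v
double+1≤double⇒< {u} {v} le =
  subst₂ _≤_ (cong suc (⌊double/2⌋ u)) (⌊double+1/2⌋ v) (⌊n/2⌋-mono (s≤s le))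

Desc-map-double : ∀ {c V} → Desc c V → Desc (double c) (map double V)
Desc-map-double [-]          = [-]
Desc-map-double (v≤c ∷ rest) = +-mono-≤ v≤c v≤c ∷ Desc-map-double rest

Desc-map-double+1 : ∀ {a U} → Desc a U → Desc (double+1 a) (map double+1 U)
Desc-map-double+1 [-]          = [-]
Desc-map-double+1 (u≤a ∷ rest) = s≤s (+-mono-≤ u≤a u≤a) ∷ Desc-map-double+1 rest

Desc-mergeHalves : ∀ {a c b} U V → Desc a U → Desc c V → double+1 a ≤ b → double c ≤ b →
                   Desc b (mergeHalves U V)
Desc-mergeHalves []      V _           dV _ cb = Desc-weaken cb (Desc-map-double dV)
Desc-mergeHalves (u ∷ U) V (u≤a ∷ dU) dV     = go V u≤a dV
  where
    go : ∀ {a c b} V → u ≤ a → Desc c V → double+1 a ≤ b → double c ≤ b →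
         Desc b (mergeHalves (u ∷ U) V)
    go []      u≤a _  ab _ = Desc-weaken ab (Desc-map-double+1 (u≤a ∷ dU))
    go (v ∷ V) u≤a (v≤c ∷ dV) ab cb with v ≤ᵇ u | ≤ᵇ-reflects-≤ v u
    ... | true  | ofʸ v≤u =
      ≤-trans (s≤s (+-mono-≤ u≤a u≤a)) ab ∷
      Desc-mergeHalves U (v ∷ V) dU (≤-refl ∷ dV) ≤-refl (≤-trans (+-mono-≤ v≤u v≤u) (n≤1+n _))
    ... | false | ofⁿ v≰u =
      ≤-trans (+-mono-≤ v≤c v≤c) cb ∷ go V ≤-refl dV (+-mono-≤ u<v (<⇒≤ u<v)) ≤-refl
      where u<v = ≰⇒> v≰u

mergeHalves-odd∷ : ∀ u U V → All (λ v → double v ≤ double+1 u) V →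
                   mergeHalves (u ∷ U) V ≡ double+1 u ∷ mergeHalves U V
mergeHalves-odd∷ u U []      _ = cong (double+1 u ∷_) (sym (mergeHalves-[] U))
mergeHalves-odd∷ u U (v ∷ V) (bound ∷ _) with v ≤ᵇ u | ≤ᵇ-reflects-≤ v u
... | true  | _        = refl
... | false | ofⁿ v≰u = contradiction (double≤double+1⇒≤ bound) v≰u

mergeHalves-even∷ : ∀ v U V → All (λ u → double+1 u ≤ double v) U →
                    mergeHalves U (v ∷ V) ≡ double v ∷ mergeHalves U V
mergeHalves-even∷ v []      V _ = refl
mergeHalves-even∷ v (u ∷ U) V (bound ∷ _) with v ≤ᵇ u | ≤ᵇ-reflects-≤ v u
... | true  | ofʸ v≤u = contradiction v≤u (<⇒≱ (double+1≤double⇒< bound))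
... | false | _       = refl

oddHalves-bounded : ∀ {b ps} → All (_≤ b) ps → All (λ u → double+1 u ≤ b) (oddHalves ps)
oddHalves-bounded [] = []
oddHalves-bounded {b} {p ∷ ps} (p≤b ∷ ps≤b) with parity p in eq
... | 1ℙ = subst (_≤ b) (sym (odd⇒double+1 p eq)) p≤b ∷ oddHalves-bounded ps≤b
... | 0ℙ = oddHalves-bounded ps≤b

evenHalves-bounded : ∀ {b ps} → All (_≤ b) ps → All (λ v → double v ≤ b) (evenHalves ps)
evenHalves-bounded [] = []
evenHalves-bounded {b} {p ∷ ps} (p≤b ∷ ps≤b) with parity p in eq
... | 1ℙ = evenHalves-bounded ps≤b
... | 0ℙ = subst (_≤ b) (sym (even⇒double p eq)) p≤b ∷ evenHalves-bounded ps≤b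

mergeHalves-halves : ∀ {b ps} → Desc b ps → mergeHalves (oddHalves ps) (evenHalves ps) ≡ ps
mergeHalves-halves [-] = refl
mergeHalves-halves {ps = p ∷ ps} (_ ∷ rest) with parity p in eq
... | 1ℙ = begin
  mergeHalves (⌊ p /2⌋ ∷ oddHalves ps) (evenHalves ps)
    ≡⟨ mergeHalves-odd∷ ⌊ p /2⌋ _ _ (subst (λ q → All (λ v → double v ≤ q) (evenHalves ps)) p≡ bounded) ⟩
  double+1 ⌊ p /2⌋ ∷ mergeHalves (oddHalves ps) (evenHalves ps)
    ≡⟨ cong₂ _∷_ (sym p≡) (mergeHalves-halves rest) ⟩
  p ∷ ps ∎
  where
    open ≡-Reasoning
    p≡ = sym (odd⇒double+1 p eq)
    bounded = evenHalves-bounded (Desc⇒All≤ rest)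
... | 0ℙ = begin
  mergeHalves (oddHalves ps) (⌊ p /2⌋ ∷ evenHalves ps)
    ≡⟨ mergeHalves-even∷ ⌊ p /2⌋ _ _ (subst (λ q → All (λ u → double+1 u ≤ q) (oddHalves ps)) p≡ bounded) ⟩
  double ⌊ p /2⌋ ∷ mergeHalves (oddHalves ps) (evenHalves ps)
    ≡⟨ cong₂ _∷_ (sym p≡) (mergeHalves-halves rest) ⟩
  p ∷ ps ∎
  where
    open ≡-Reasoning
    p≡ = sym (even⇒double p eq)
    bounded = oddHalves-bounded (Desc⇒All≤ rest)

Desc-oddHalves : ∀ {b ps} → Desc b ps → Desc ⌊ b /2⌋ (oddHalves ps)
Desc-oddHalves [-] = [-]
Desc-oddHalves {ps = p ∷ ps} (p≤b ∷ rest) with parity p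
... | 1ℙ = ⌊n/2⌋-mono p≤b ∷ Desc-oddHalves rest
... | 0ℙ = Desc-weaken (⌊n/2⌋-mono p≤b) (Desc-oddHalves rest)

Desc-evenHalves : ∀ {b ps} → Desc b ps → Desc ⌊ b /2⌋ (evenHalves ps)
Desc-evenHalves [-] = [-]
Desc-evenHalves {ps = p ∷ ps} (p≤b ∷ rest) with parity p
... | 1ℙ = Desc-weaken (⌊n/2⌋-mono p≤b) (Desc-evenHalves rest)
... | 0ℙ = ⌊n/2⌋-mono p≤b ∷ Desc-evenHalves rest

DecreasingPair : Pred (List ℕ × List ℕ) 0ℓ
DecreasingPair (U , V) = Linked _≥_ U × Linked _≥_ V

halves : List ℕ → List ℕ × List ℕ
halves ps = oddHalves ps , evenHalves ps

length-halves : ∀ ps → length (oddHalves ps) + length (evenHalves ps) ≡ length ps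
length-halves []       = refl
length-halves (p ∷ ps) with parity p
... | 1ℙ = cong suc (length-halves ps)
... | 0ℙ = trans (+-suc _ _) (cong suc (length-halves ps))

decreasing≅pairs : Linked _≥_ ≅ DecreasingPair
decreasing≅pairs = record
  { to      = halves
  ; from    = uncurry mergeHalves
  ; to-∈    = λ lk → Desc⇒Linked (Desc-oddHalves (Linked⇒Desc lk)) , Desc⇒Linked (Desc-evenHalves (Linked⇒Desc lk))
  ; from-∈  = λ { {U , V} (lkU , lkV) → Desc⇒Linked (Desc-mergeHalves U V (Linked⇒Desc lkU) (Linked⇒Desc lkV)
                                          (m≤m+n _ (double (largest V))) (m≤n+m _ (double+1 (largest U)))) }
  ; from∘to = mergeHalves-halves ∘ Linked⇒Desc
  ; to∘from = λ { {U , V} _ → cong₂ _,_ (oddHalves-mergeHalves U V) (evenHalves-mergeHalves U V) }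
  }

mergeHalves-↭ : ∀ U V → mergeHalves U V ↭ map double+1 U ++ map double V
mergeHalves-↭ []      V  = ↭-refl
mergeHalves-↭ (u ∷ U) [] = ↭-sym (↭-++-identityʳ (map double+1 (u ∷ U)))
mergeHalves-↭ (u ∷ U) (v ∷ V) with v ≤ᵇ u | mergeHalves-↭ U (v ∷ V) | mergeHalves-↭ (u ∷ U) V
... | true  | ih | _  = prep (double+1 u) ih
... | false | _  | ih =
  ↭-trans (prep (double v) ih) (↭-sym (shift (double v) (map double+1 (u ∷ U)) (map double V)))

length-mergeHalves : ∀ U V → length (mergeHalves U V) ≡ length U + length V
length-mergeHalves U V = begin
  length (mergeHalves U V)                  ≡⟨ ↭-length (mergeHalves-↭ U V) ⟩
  length (map double+1 U ++ map double V)   ≡⟨ length-++ (map double+1 U) ⟩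
  length (map double+1 U) + length (map double V) ≡⟨ cong₂ _+_ (length-map double+1 U) (length-map double V) ⟩
  length U + length V                       ∎
  where open ≡-Reasoning

sum-map-double : ∀ V → sum (map double V) ≡ double (sum V)
sum-map-double []      = refl
sum-map-double (v ∷ V) = trans (cong (double v +_) (sum-map-double V)) (interchange v v (sum V) (sum V))

sum-map-double+1 : ∀ U → sum (map double+1 U) ≡ length U + double (sum U)
sum-map-double+1 []      = refl
sum-map-double+1 (u ∷ U) =
  cong suc (trans (cong (double u +_) (sum-map-double+1 U)) (rearrange u (length U) (sum U)))
  where
    rearrange : ∀ u ℓ s → u + u + (ℓ + (s + s)) ≡ ℓ + (u + s + (u + s))
    rearrange = solve-∀

sum-mergeHalves : ∀ U V → sum (mergeHalves U V) ≡ length U + double (sum U) + double (sum V)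
sum-mergeHalves U V = begin
  sum (mergeHalves U V)                            ≡⟨ sum-↭ (mergeHalves-↭ U V) ⟩
  sum (map double+1 U ++ map double V)             ≡⟨ sum-++ (map double+1 U) (map double V) ⟩
  sum (map double+1 U) + sum (map double V)        ≡⟨ cong₂ _+_ (sum-map-double+1 U) (sum-map-double V) ⟩
  length U + double (sum U) + double (sum V)       ∎
  where open ≡-Reasoning

-- Conjugation

addColumn : ℕ → List ℕ → List ℕ
addColumn h C = map suc C ++ replicate (h ∸ length C) 1

conjugate : List ℕ → List ℕ
conjugate []      = []
conjugate (v ∷ V) = addColumn v (conjugate V)

dropColumn : List ℕ → List ℕ
dropColumn []                = []
dropColumn (zero ∷ B)        = dropColumn B
dropColumn (suc zero ∷ B)    = dropColumn B
dropColumn (suc (suc b) ∷ B) = suc b ∷ dropColumn B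

columns : ℕ → List ℕ → List ℕ
columns zero    B = []
columns (suc m) B = length B ∷ columns m (dropColumn B)

Positive-map-suc : ∀ xs → Positive (map suc xs)
Positive-map-suc xs = map⁺ (All.universal (λ _ → s≤s z≤n) xs)

Positive-conjugate : ∀ V → Positive (conjugate V)
Positive-conjugate []      = []
Positive-conjugate (v ∷ V) = ++⁺ (Positive-map-suc (conjugate V)) (replicate⁺ _ (s≤s z≤n))

Desc-map-suc : ∀ {b xs} → Desc b xs → Desc (suc b) (map suc xs)
Desc-map-suc [-]          = [-]
Desc-map-suc (x≤b ∷ rest) = s≤s x≤b ∷ Desc-map-suc rest

Desc-replicate : ∀ n {x} → Desc x (replicate n x)
Desc-replicate zero    = [-]
Desc-replicate (suc n) = ≤-refl ∷ Desc-replicate n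

Desc-++ : ∀ {b c xs ys} → Desc b xs → All (c ≤_) xs → Desc c ys → c ≤ b → Desc b (xs ++ ys)
Desc-++ [-]          []          dys c≤b = Desc-weaken c≤b dys
Desc-++ (x≤b ∷ dxs) (c≤x ∷ c≤xs) dys _   = x≤b ∷ Desc-++ dxs c≤xs dys c≤x

length-addColumn : ∀ h C → length C ≤ h → length (addColumn h C) ≡ h
length-addColumn h C ℓ≤h = begin
  length (map suc C ++ replicate (h ∸ length C) 1)               ≡⟨ length-++ (map suc C) ⟩
  length (map suc C) + length (replicate (h ∸ length C) 1)
    ≡⟨ cong₂ _+_ (length-map suc C) (length-replicate (h ∸ length C)) ⟩
  length C + (h ∸ length C)                                      ≡⟨ m+[n∸m]≡n ℓ≤h ⟩
  h                                                              ∎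
  where open ≡-Reasoning

length-conjugate : ∀ {b V} → Desc b V → length (conjugate V) ≡ largest V
length-conjugate [-] = refl
length-conjugate {V = v ∷ V} (_ ∷ rest) =
  length-addColumn v (conjugate V) (subst (_≤ v) (sym (length-conjugate rest)) (Desc-largest rest))

Desc-conjugate : ∀ {b V} → Desc b V → Desc (length V) (conjugate V)
Desc-conjugate [-] = [-]
Desc-conjugate {V = v ∷ V} (_ ∷ rest) =
  Desc-++ (Desc-map-suc (Desc-conjugate rest)) (Positive-map-suc (conjugate V)) (Desc-replicate _) (s≤s z≤n)

sum-map-suc : ∀ xs → sum (map suc xs) ≡ length xs + sum xs
sum-map-suc []       = refl
sum-map-suc (x ∷ xs) = cong suc (trans (cong (x +_) (sum-map-suc xs)) (x∙yz≈y∙xz x (length xs) (sum xs)))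

sum-replicate-1 : ∀ n → sum (replicate n 1) ≡ n
sum-replicate-1 zero    = refl
sum-replicate-1 (suc n) = cong suc (sum-replicate-1 n)

sum-addColumn : ∀ h C → length C ≤ h → sum (addColumn h C) ≡ h + sum C
sum-addColumn h C ℓ≤h = begin
  sum (map suc C ++ replicate (h ∸ length C) 1)             ≡⟨ sum-++ (map suc C) _ ⟩
  sum (map suc C) + sum (replicate (h ∸ length C) 1)
    ≡⟨ cong₂ _+_ (sum-map-suc C) (sum-replicate-1 (h ∸ length C)) ⟩
  length C + sum C + (h ∸ length C)                         ≡⟨ +-assoc (length C) (sum C) _ ⟩
  length C + (sum C + (h ∸ length C))                       ≡⟨ cong (length C +_) (+-comm (sum C) _) ⟩
  length C + ((h ∸ length C) + sum C)                       ≡⟨ sym (+-assoc (length C) _ (sum C)) ⟩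
  length C + (h ∸ length C) + sum C                         ≡⟨ cong (_+ sum C) (m+[n∸m]≡n ℓ≤h) ⟩
  h + sum C                                                 ∎
  where open ≡-Reasoning

sum-conjugate : ∀ {b V} → Desc b V → sum (conjugate V) ≡ sum V
sum-conjugate [-] = refl
sum-conjugate {V = v ∷ V} (_ ∷ rest) = begin
  sum (addColumn v (conjugate V)) ≡⟨ sum-addColumn v (conjugate V) ℓ≤v ⟩
  v + sum (conjugate V)           ≡⟨ cong (v +_) (sum-conjugate rest) ⟩
  v + sum V                       ∎
  where
    open ≡-Reasoning
    ℓ≤v = subst (_≤ v) (sym (length-conjugate rest)) (Desc-largest rest)

dropColumn-++ : ∀ A B → dropColumn (A ++ B) ≡ dropColumn A ++ dropColumn B
dropColumn-++ []                B = refl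
dropColumn-++ (zero ∷ A)        B = dropColumn-++ A B
dropColumn-++ (suc zero ∷ A)    B = dropColumn-++ A B
dropColumn-++ (suc (suc a) ∷ A) B = cong (suc a ∷_) (dropColumn-++ A B)

dropColumn-map-suc : ∀ {xs} → Positive xs → dropColumn (map suc xs) ≡ xs
dropColumn-map-suc []                        = refl
dropColumn-map-suc {suc x ∷ xs} (_ ∷ rest) = cong (suc x ∷_) (dropColumn-map-suc rest)

dropColumn-replicate-1 : ∀ n → dropColumn (replicate n 1) ≡ []
dropColumn-replicate-1 zero    = refl
dropColumn-replicate-1 (suc n) = dropColumn-replicate-1 n

dropColumn-addColumn : ∀ h {C} → Positive C → dropColumn (addColumn h C) ≡ C
dropColumn-addColumn h {C} pos = begin
  dropColumn (map suc C ++ replicate (h ∸ length C) 1)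
    ≡⟨ dropColumn-++ (map suc C) _ ⟩
  dropColumn (map suc C) ++ dropColumn (replicate (h ∸ length C) 1)
    ≡⟨ cong₂ _++_ (dropColumn-map-suc pos) (dropColumn-replicate-1 (h ∸ length C)) ⟩
  C ++ []
    ≡⟨ ++-identityʳ C ⟩
  C ∎
  where open ≡-Reasoning

columns-conjugate : ∀ {b V} → Desc b V → columns (length V) (conjugate V) ≡ V
columns-conjugate [-] = refl
columns-conjugate {V = v ∷ V} d@(_ ∷ rest) rewrite dropColumn-addColumn v (Positive-conjugate V) =
  cong₂ _∷_ (length-conjugate d) (columns-conjugate rest)

length-columns : ∀ m B → length (columns m B) ≡ m
length-columns zero    B = refl
length-columns (suc m) B = cong suc (length-columns m (dropColumn B))

Desc-dropColumn : ∀ {m B} → Desc (suc m) B → Desc m (dropColumn B)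
Desc-dropColumn [-] = [-]
Desc-dropColumn {B = zero ∷ B}        (_ ∷ rest)         = Desc-dropColumn (Desc-weaken z≤n rest)
Desc-dropColumn {B = suc zero ∷ B}    (_ ∷ rest)         = Desc-dropColumn (Desc-weaken (s≤s z≤n) rest)
Desc-dropColumn {B = suc (suc b) ∷ B} (s≤s b<m ∷ rest) = b<m ∷ Desc-dropColumn rest

Positive-dropColumn : ∀ B → Positive (dropColumn B)
Positive-dropColumn []                = []
Positive-dropColumn (zero ∷ B)        = Positive-dropColumn B
Positive-dropColumn (suc zero ∷ B)    = Positive-dropColumn B
Positive-dropColumn (suc (suc b) ∷ B) = s≤s z≤n ∷ Positive-dropColumn B

length-dropColumn : ∀ B → length (dropColumn B) ≤ length B
length-dropColumn []                = z≤n
length-dropColumn (zero ∷ B)        = m≤n⇒m≤1+n (length-dropColumn B)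
length-dropColumn (suc zero ∷ B)    = m≤n⇒m≤1+n (length-dropColumn B)
length-dropColumn (suc (suc b) ∷ B) = s≤s (length-dropColumn B)

addColumn-replicate-1 : ∀ n → addColumn (length (replicate n 1)) (dropColumn (replicate n 1)) ≡ replicate n 1
addColumn-replicate-1 n rewrite dropColumn-replicate-1 n | length-replicate n {1} = refl

Desc1-Positive⇒ones : ∀ {B} → Desc 1 B → Positive B → B ≡ replicate (length B) 1
Desc1-Positive⇒ones [-] [] = refl
Desc1-Positive⇒ones {suc zero ∷ B}    (_ ∷ rest)     (_ ∷ pos) = cong (1 ∷_) (Desc1-Positive⇒ones rest pos)
Desc1-Positive⇒ones {suc (suc _) ∷ B} (s≤s () ∷ _) _

addColumn-dropColumn : ∀ {b B} → Desc b B → Positive B → addColumn (length B) (dropColumn B) ≡ B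
addColumn-dropColumn [-] [] = refl
addColumn-dropColumn {B = suc zero ∷ B} (_ ∷ rest) (_ ∷ pos) =
  subst (λ X → addColumn (length X) (dropColumn X) ≡ X) (cong (1 ∷_) (sym (Desc1-Positive⇒ones rest pos)))
        (addColumn-replicate-1 (suc (length B)))
addColumn-dropColumn {B = suc (suc b) ∷ B} (_ ∷ rest) (_ ∷ pos) =
  cong (suc (suc b) ∷_) (addColumn-dropColumn rest pos)

conjugate-columns : ∀ {m B} → Desc m B → Positive B → conjugate (columns m B) ≡ B
conjugate-columns {zero}      d pos = sym (Positive-largest≤0 pos (Desc-largest d))
conjugate-columns {suc m} {B} d pos = begin
  addColumn (length B) (conjugate (columns m (dropColumn B)))
    ≡⟨ cong (addColumn (length B)) (conjugate-columns (Desc-dropColumn d) (Positive-dropColumn B)) ⟩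
  addColumn (length B) (dropColumn B)
    ≡⟨ addColumn-dropColumn d pos ⟩
  B ∎
  where open ≡-Reasoning

Desc-columns : ∀ {m B} → Desc m B → Desc (length B) (columns m B)
Desc-columns {zero}      _ = [-]
Desc-columns {suc m} {B} d = ≤-refl ∷ Desc-weaken (length-dropColumn B) (Desc-columns (Desc-dropColumn d))

-- Pairs of partitions of fixed charge

charge : ℕ → ℕ → ℕ
charge zero    e       = e
charge (suc o) zero    = o
charge (suc o) (suc e) = charge o e

charge-≤ : ∀ {o e} → o ≤ e → charge o e ≡ e ∸ o
charge-≤ {zero}          _         = refl
charge-≤ {suc o} {suc e} (s≤s o≤e) = charge-≤ o≤e

charge-> : ∀ {o e} → e < o → charge o e ≡ o ∸ suc e
charge-> {suc o} {zero}  _         = refl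
charge-> {suc o} {suc e} (s≤s e<o) = charge-> e<o

charge-triangle : ∀ o e → triangle (o + e) + o ≡ triangle (charge o e) + double (o * suc e)
charge-triangle zero    e    = refl
charge-triangle (suc o) zero rewrite +-identityʳ o = expand o (triangle o)
  where
    expand : ∀ o t → suc (o + t + suc o) ≡ t + (suc (o * 1) + suc (o * 1))
    expand = solve-∀
charge-triangle (suc o) (suc e) rewrite +-suc o e = begin
  suc (suc (o + e)) + (suc (o + e) + triangle (o + e)) + suc o   ≡⟨ regroup o e (triangle (o + e)) ⟩
  triangle (o + e) + o + (o + e + 2) * 2                        ≡⟨ cong (_+ (o + e + 2) * 2) (charge-triangle o e) ⟩
  triangle (charge o e) + double (o * suc e) + (o + e + 2) * 2  ≡⟨ expand o e (triangle (charge o e)) ⟩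
  triangle (charge o e) + double (suc o * suc (suc e))          ∎
  where
    open ≡-Reasoning
    regroup : ∀ o e t → suc (suc (o + e)) + (suc (o + e) + t) + suc o ≡ t + o + (o + e + 2) * 2
    regroup = solve-∀
    expand : ∀ o e t → t + (o * suc e + o * suc e) + (o + e + 2) * 2
                     ≡ t + (suc o * suc (suc e) + suc o * suc (suc e))
    expand = solve-∀

takeAbove : ℕ → List ℕ → List ℕ
takeAbove s []       = []
takeAbove s (x ∷ xs) = if s <ᵇ x then x ∷ takeAbove (suc s) xs else []

dropAbove : ℕ → List ℕ → List ℕ
dropAbove s []       = []
dropAbove s (x ∷ xs) = if s <ᵇ x then dropAbove (suc s) xs else x ∷ xs

takeAbove-++-dropAbove : ∀ s xs → takeAbove s xs ++ dropAbove s xs ≡ xs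
takeAbove-++-dropAbove s []       = refl
takeAbove-++-dropAbove s (x ∷ xs) with s <ᵇ x
... | true  = cong (x ∷_) (takeAbove-++-dropAbove (suc s) xs)
... | false = refl

takeAbove-dropAbove-shifted : ∀ X B s c → length X + s ≡ c → largest B ≤ c →
                takeAbove s (map (_+ c) X ++ B) ≡ map (_+ c) X × dropAbove s (map (_+ c) X ++ B) ≡ B
takeAbove-dropAbove-shifted [] [] s c _ _ = refl , refl
takeAbove-dropAbove-shifted [] (b ∷ B) s c s≡c b≤c with s <ᵇ b | <ᵇ-reflects-< s b
... | true  | ofʸ s<b = contradiction (subst (b ≤_) (sym s≡c) b≤c) (<⇒≱ s<b)
... | false | _       = refl , refl
takeAbove-dropAbove-shifted (x ∷ X) B s c ℓ+s≡c hB≤c with s <ᵇ x + c | <ᵇ-reflects-< s (x + c)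
... | true  | _ =
  map₁ (cong (x + c ∷_)) (takeAbove-dropAbove-shifted X B (suc s) c (trans (+-suc (length X) s) ℓ+s≡c) hB≤c)
... | false | ofⁿ s≮x+c =
  contradiction (≤-trans (subst (suc s ≤_) ℓ+s≡c (s≤s (m≤n+m s (length X)))) (m≤n+m c x)) s≮x+c

takeAbove-length : ∀ {x} s xs → Desc x xs → s < x → length (takeAbove (suc s) xs) + suc s ≤ x
takeAbove-length s []       _            s<x = s<x
takeAbove-length s (y ∷ ys) (y≤x ∷ rest) s<x with suc s <ᵇ y | <ᵇ-reflects-< (suc s) y
... | true  | ofʸ s+1<y =
  ≤-trans (≤-reflexive (sym (+-suc (length (takeAbove (suc (suc s)) ys)) (suc s))))
          (≤-trans (takeAbove-length (suc s) ys rest s+1<y) y≤x)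
... | false | _ = s<x

takeAbove-bounded : ∀ {b} s xs → Desc b xs → All (length (takeAbove s xs) + s ≤_) (takeAbove s xs)
takeAbove-bounded s []       _            = []
takeAbove-bounded s (x ∷ xs) (_ ∷ rest) with s <ᵇ x | <ᵇ-reflects-< s x
... | true  | ofʸ s<x =
  subst (_≤ x) ℓ+s+1≡ (takeAbove-length s xs rest s<x) ∷
  All.map (λ {t} → subst (_≤ t) ℓ+s+1≡) (takeAbove-bounded (suc s) xs rest)
  where ℓ+s+1≡ = +-suc (length (takeAbove (suc s) xs)) s
... | false | _ = []

largest-dropAbove : ∀ s xs → largest (dropAbove s xs) ≤ length (takeAbove s xs) + s
largest-dropAbove s []       = z≤n
largest-dropAbove s (x ∷ xs) with s <ᵇ x | <ᵇ-reflects-< s x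
... | true  | _       =
  subst (largest (dropAbove (suc s) xs) ≤_) (+-suc (length (takeAbove (suc s) xs)) s)
        (largest-dropAbove (suc s) xs)
... | false | ofⁿ s≮x = ≮⇒≥ s≮x

Desc-takeAbove : ∀ {b} s xs → Desc b xs → Desc b (takeAbove s xs)
Desc-takeAbove s []       _            = [-]
Desc-takeAbove s (x ∷ xs) (x≤b ∷ rest) with s <ᵇ x
... | true  = x≤b ∷ Desc-takeAbove (suc s) xs rest
... | false = [-]

Desc-dropAbove : ∀ {b} s xs → Desc b xs → Desc b (dropAbove s xs)
Desc-dropAbove s []       _                = [-]
Desc-dropAbove s (x ∷ xs) d@(x≤b ∷ rest) with s <ᵇ x
... | true  = Desc-weaken x≤b (Desc-dropAbove (suc s) xs rest)
... | false = d

Positive-dropAbove : ∀ s {xs} → Positive xs → Positive (dropAbove s xs)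
Positive-dropAbove s []                     = []
Positive-dropAbove s {x ∷ xs} pos@(_ ∷ rest) with s <ᵇ x
... | true  = Positive-dropAbove (suc s) rest
... | false = pos

encode : List ℕ × List ℕ → List ℕ
encode (U , V) =
  if length U ≤ᵇ length V
  then map (_+ suc (length V)) U ++ conjugate V
  else map (_+ length U) V ++ length U ∷ conjugate U

encode-wide : ∀ U V → length U ≤ length V → encode (U , V) ≡ map (_+ suc (length V)) U ++ conjugate V
encode-wide U V o≤e with length U ≤ᵇ length V | ≤ᵇ-reflects-≤ (length U) (length V)
... | true  | _       = refl
... | false | ofⁿ o≰e = contradiction o≤e o≰e

encode-tall : ∀ U V → length V < length U → encode (U , V) ≡ map (_+ length U) V ++ length U ∷ conjugate U
encode-tall U V e<o with length U ≤ᵇ length V | ≤ᵇ-reflects-≤ (length U) (length V)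
... | true  | ofʸ o≤e = contradiction o≤e (<⇒≱ e<o)
... | false | _       = refl

-- For ν = encode (U , V) of charge k, T = takeAbove (suc k) ν is the longest prefix with νᵢ > k + 1 + i.
-- For o ≤ e it is the o rows of the rectangle, of width q = |T| + k + 1; otherwise it is the first e rows
-- of the rectangle, and B starts with its last row, of length q.
decodeFrom : ℕ → List ℕ → List ℕ → List ℕ × List ℕ
decodeFrom k T B =
  if largest B <ᵇ length T + suc k
  then (map (_∸ (length T + suc k)) T , columns (length T + k) B)
  else (columns (length T + suc k) (drop 1 B) , map (_∸ (length T + suc k)) T)

decode : ℕ → List ℕ → List ℕ × List ℕ
decode k ν = decodeFrom k (takeAbove (suc k) ν) (dropAbove (suc k) ν)

decodeFrom-wide : ∀ k T B → largest B < length T + suc k →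
                  decodeFrom k T B ≡ (map (_∸ (length T + suc k)) T , columns (length T + k) B)
decodeFrom-wide k T B lt with largest B <ᵇ length T + suc k | <ᵇ-reflects-< (largest B) (length T + suc k)
... | true  | _       = refl
... | false | ofⁿ ≮  = contradiction lt ≮

decodeFrom-tall : ∀ k T B → ¬ largest B < length T + suc k →
                  decodeFrom k T B ≡ (columns (length T + suc k) (drop 1 B) , map (_∸ (length T + suc k)) T)
decodeFrom-tall k T B ≮ with largest B <ᵇ length T + suc k | <ᵇ-reflects-< (largest B) (length T + suc k)
... | true  | ofʸ lt = contradiction lt ≮
... | false | _      = refl

map-+-∸ : ∀ c X → map (_∸ c) (map (_+ c) X) ≡ X
map-+-∸ c X = trans (sym (map-∘ X)) (map-id-local (All.universal (λ x → m+n∸n≡m x c) X))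

map-∸-+ : ∀ {c X} → All (c ≤_) X → map (_+ c) (map (_∸ c) X) ≡ X
map-∸-+ {X = X} c≤X = trans (sym (map-∘ X)) (map-id-local (All.map m∸n+n≡m c≤X))

decode-wide : ∀ k X B c → length X + suc k ≡ c → largest B < c →
              decode k (map (_+ c) X ++ B) ≡ (X , columns (length X + k) B)
decode-wide k X B c ℓ+k+1≡c hB<c = begin
  decode k (map (_+ c) X ++ B)          ≡⟨ cong₂ (decodeFrom k) takeX dropX ⟩
  decodeFrom k (map (_+ c) X) B         ≡⟨ decodeFrom-wide k (map (_+ c) X) B (subst (largest B <_) (sym q≡c) hB<c) ⟩
  (map (_∸ q) (map (_+ c) X) , columns (length (map (_+ c) X) + k) B)
    ≡⟨ cong₂ _,_ (trans (cong (λ q → map (_∸ q) (map (_+ c) X)) q≡c) (map-+-∸ c X))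
                 (cong (λ ℓ → columns (ℓ + k) B) (length-map (_+ c) X)) ⟩
  (X , columns (length X + k) B)        ∎
  where
    open ≡-Reasoning
    q = length (map (_+ c) X) + suc k
    q≡c = trans (cong (_+ suc k) (length-map (_+ c) X)) ℓ+k+1≡c
    takeX = proj₁ (takeAbove-dropAbove-shifted X B (suc k) c ℓ+k+1≡c (<⇒≤ hB<c))
    dropX = proj₂ (takeAbove-dropAbove-shifted X B (suc k) c ℓ+k+1≡c (<⇒≤ hB<c))

decode-tall : ∀ k X B c → length X + suc k ≡ c → decode k (map (_+ c) X ++ c ∷ B) ≡ (columns c B , X)
decode-tall k X B c ℓ+k+1≡c = begin
  decode k (map (_+ c) X ++ c ∷ B)      ≡⟨ cong₂ (decodeFrom k) takeX dropX ⟩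
  decodeFrom k (map (_+ c) X) (c ∷ B)   ≡⟨ decodeFrom-tall k (map (_+ c) X) (c ∷ B) (<-irrefl (sym q≡c)) ⟩
  (columns q B , map (_∸ q) (map (_+ c) X))
    ≡⟨ cong₂ _,_ (cong (λ q → columns q B) q≡c)
                 (trans (cong (λ q → map (_∸ q) (map (_+ c) X)) q≡c) (map-+-∸ c X)) ⟩
  (columns c B , X)                     ∎
  where
    open ≡-Reasoning
    q = length (map (_+ c) X) + suc k
    q≡c = trans (cong (_+ suc k) (length-map (_+ c) X)) ℓ+k+1≡c
    takeX = proj₁ (takeAbove-dropAbove-shifted X (c ∷ B) (suc k) c ℓ+k+1≡c ≤-refl)
    dropX = proj₂ (takeAbove-dropAbove-shifted X (c ∷ B) (suc k) c ℓ+k+1≡c ≤-refl)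

pairCharge : List ℕ × List ℕ → ℕ
pairCharge (U , V) = charge (length U) (length V)

HasCharge : ℕ → Pred (List ℕ × List ℕ) 0ℓ
HasCharge k p = pairCharge p ≡ k

decode-encode : ∀ {U V} → DecreasingPair (U , V) → decode (pairCharge (U , V)) (encode (U , V)) ≡ (U , V)
decode-encode {U} {V} (lkU , lkV) with length U ≤? length V
... | yes o≤e = begin
  decode (charge o e) (encode (U , V))                 ≡⟨ cong₂ decode (charge-≤ o≤e) (encode-wide U V o≤e) ⟩
  decode (e ∸ o) (map (_+ suc e) U ++ conjugate V)     ≡⟨ decode-wide (e ∸ o) U (conjugate V) (suc e) o+k+1≡ hC<e+1 ⟩
  (U , columns (o + (e ∸ o)) (conjugate V))            ≡⟨ cong (λ m → U , columns m (conjugate V)) (m+[n∸m]≡n o≤e) ⟩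
  (U , columns e (conjugate V))                        ≡⟨ cong (U ,_) (columns-conjugate (Linked⇒Desc lkV)) ⟩
  (U , V)                                              ∎
  where
    open ≡-Reasoning
    o = length U
    e = length V
    o+k+1≡ = trans (+-suc o (e ∸ o)) (cong suc (m+[n∸m]≡n o≤e))
    hC<e+1 = s≤s (Desc-largest (Desc-conjugate (Linked⇒Desc lkV)))
... | no o≰e = begin
  decode (charge o e) (encode (U , V))                 ≡⟨ cong₂ decode (charge-> e<o) (encode-tall U V e<o) ⟩
  decode (o ∸ suc e) (map (_+ o) V ++ o ∷ conjugate U) ≡⟨ decode-tall (o ∸ suc e) V (conjugate U) o e+k+1≡ ⟩
  (columns o (conjugate U) , V)                        ≡⟨ cong (_, V) (columns-conjugate (Linked⇒Desc lkU)) ⟩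
  (U , V)                                              ∎
  where
    open ≡-Reasoning
    o = length U
    e = length V
    e<o = ≰⇒> o≰e
    e+k+1≡ = trans (+-suc e (o ∸ suc e)) (m+[n∸m]≡n e<o)

Desc-map-∸ : ∀ {b X} c → Desc b X → Desc (b ∸ c) (map (_∸ c) X)
Desc-map-∸ c [-]          = [-]
Desc-map-∸ c (x≤b ∷ rest) = ∸-monoˡ-≤ c x≤b ∷ Desc-map-∸ c rest

largest≡⇒∷ : ∀ {xs q} → 0 < q → largest xs ≡ q → xs ≡ q ∷ drop 1 xs
largest≡⇒∷ {[]}     () refl
largest≡⇒∷ {x ∷ xs} _  refl = refl

DecodeSound : ℕ → List ℕ → Set
DecodeSound k ν = (DecreasingPair ∩ HasCharge k) (decode k ν) × encode (decode k ν) ≡ ν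

module _ {b : ℕ} (k : ℕ) (ν : List ℕ) (dν : Desc b ν) (posν : Positive ν) where
  private
    T = takeAbove (suc k) ν
    B = dropAbove (suc k) ν
    p = length T
    q = p + suc k
    dT : Desc b T
    dT = Desc-takeAbove (suc k) ν dν
    dB : Desc b B
    dB = Desc-dropAbove (suc k) ν dν
    posB : Positive B
    posB = Positive-dropAbove (suc k) posν
    q≤T : All (q ≤_) T
    q≤T = takeAbove-bounded (suc k) ν dν
    T++B≡ν : T ++ B ≡ ν
    T++B≡ν = takeAbove-++-dropAbove (suc k) ν

  decode-sound-wide : largest B < q → DecodeSound k ν
  decode-sound-wide hB<q rewrite decodeFrom-wide k T B hB<q =
    ((Desc⇒Linked (Desc-map-∸ q dT) , Desc⇒Linked (Desc-columns dBk)) , charge≡k) , encode≡ν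
    where
      U = map (_∸ q) T
      V = columns (p + k) B
      dBk : Desc (p + k) B
      dBk = Desc-weaken (≤-pred (subst (largest B <_) (+-suc p k) hB<q)) (Desc-tight dB)
      charge≡k : charge (length U) (length V) ≡ k
      charge≡k rewrite length-map (_∸ q) T | length-columns (p + k) B =
        trans (charge-≤ (m≤m+n p k)) (m+n∸m≡n p k)
      o≤e : length U ≤ length V
      o≤e rewrite length-map (_∸ q) T | length-columns (p + k) B = m≤m+n p k
      encode≡ν : encode (U , V) ≡ ν
      encode≡ν = begin
        encode (U , V)                               ≡⟨ encode-wide U V o≤e ⟩
        map (_+ suc (length V)) U ++ conjugate V      ≡⟨ cong (λ c → map (_+ c) U ++ conjugate V) e+1≡q ⟩
        map (_+ q) U ++ conjugate V                   ≡⟨ cong₂ _++_ (map-∸-+ q≤T) (conjugate-columns dBk posB) ⟩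
        T ++ B                                        ≡⟨ T++B≡ν ⟩
        ν                                             ∎
        where
          open ≡-Reasoning
          e+1≡q = trans (cong suc (length-columns (p + k) B)) (sym (+-suc p k))

  decode-sound-tall : ¬ largest B < q → DecodeSound k ν
  decode-sound-tall hB≮q rewrite decodeFrom-tall k T B hB≮q =
    ((Desc⇒Linked (Desc-columns dB′) , Desc⇒Linked (Desc-map-∸ q dT)) , charge≡k) , encode≡ν
    where
      B′ = drop 1 B
      B≡ : B ≡ q ∷ B′
      B≡ = largest≡⇒∷ (subst (0 <_) (sym (+-suc p k)) (s≤s z≤n))
                      (≤-antisym (largest-dropAbove (suc k) ν) (≮⇒≥ hB≮q))
      dB′ : Desc q B′
      dB′ = Linked.tail (subst (Desc b) B≡ dB)
      U = columns q B′
      V = map (_∸ q) T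
      q≡ : q ≡ suc (p + k)
      q≡ = +-suc p k
      charge≡k : charge (length U) (length V) ≡ k
      charge≡k rewrite length-columns q B′ | length-map (_∸ q) T | q≡ =
        trans (charge-> (s≤s (m≤m+n p k))) (m+n∸m≡n p k)
      e<o : length V < length U
      e<o rewrite length-columns q B′ | length-map (_∸ q) T | q≡ = s≤s (m≤m+n p k)
      encode≡ν : encode (U , V) ≡ ν
      encode≡ν = begin
        encode (U , V)                               ≡⟨ encode-tall U V e<o ⟩
        map (_+ length U) V ++ length U ∷ conjugate U
          ≡⟨ cong (λ c → map (_+ c) V ++ c ∷ conjugate U) (length-columns q B′) ⟩
        map (_+ q) V ++ q ∷ conjugate U
          ≡⟨ cong₂ (λ X Y → X ++ q ∷ Y) (map-∸-+ q≤T) (conjugate-columns dB′ posB′) ⟩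
        T ++ q ∷ B′                                   ≡⟨ cong (T ++_) (sym B≡) ⟩
        T ++ B                                        ≡⟨ T++B≡ν ⟩
        ν                                             ∎
        where
          open ≡-Reasoning
          posB′ = All.tail (subst Positive B≡ posB)

decode-sound : ∀ {b} k ν → Desc b ν → Positive ν → DecodeSound k ν
decode-sound k ν dν posν with largest (dropAbove (suc k) ν) <? length (takeAbove (suc k) ν) + suc k
... | yes hB<q = decode-sound-wide k ν dν posν hB<q
... | no  hB≮q = decode-sound-tall k ν dν posν hB≮q

Desc-map-+ : ∀ {b X} c → Desc b X → Desc (b + c) (map (_+ c) X)
Desc-map-+ c [-]          = [-]
Desc-map-+ c (x≤b ∷ rest) = +-monoˡ-≤ c x≤b ∷ Desc-map-+ c rest

IsPartition-shifted++ : ∀ {b c X B} → Desc b X → Desc c B → Positive B → 0 < c → IsPartition (map (_+ c) X ++ B)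
IsPartition-shifted++ {b} {c} {X} dX dB posB 0<c =
  Desc⇒Linked (Desc-++ (Desc-map-+ c dX) c≤X+c dB (m≤n+m c b)) ,
  ++⁺ (All.map (≤-trans 0<c) c≤X+c) posB
  where
    c≤X+c : All (c ≤_) (map (_+ c) X)
    c≤X+c = map⁺ (All.universal (λ x → m≤n+m c x) X)

encode-partition : ∀ {U V} → DecreasingPair (U , V) → IsPartition (encode (U , V))
encode-partition {U} {V} (lkU , lkV) with length U ≤? length V
... | yes o≤e = subst IsPartition (sym (encode-wide U V o≤e))
  (IsPartition-shifted++ (Linked⇒Desc lkU) (Desc-weaken (n≤1+n _) (Desc-conjugate (Linked⇒Desc lkV)))
                         (Positive-conjugate V) (s≤s z≤n))
... | no  o≰e = subst IsPartition (sym (encode-tall U V (≰⇒> o≰e)))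
  (IsPartition-shifted++ (Linked⇒Desc lkV) (≤-refl ∷ Desc-conjugate (Linked⇒Desc lkU))
                         (0<o ∷ Positive-conjugate U) 0<o)
  where 0<o = ≤-trans (s≤s z≤n) (≰⇒> o≰e)

sum-map-+ : ∀ c X → sum (map (_+ c) X) ≡ sum X + length X * c
sum-map-+ c []      = refl
sum-map-+ c (x ∷ X) = trans (cong (x + c +_) (sum-map-+ c X)) (rearrange x c (sum X) (length X))
  where
    rearrange : ∀ x c s ℓ → x + c + (s + ℓ * c) ≡ x + s + (c + ℓ * c)
    rearrange = solve-∀

sum-encode : ∀ {U V} → DecreasingPair (U , V) → sum (encode (U , V)) ≡ length U * suc (length V) + sum U + sum V
sum-encode {U} {V} (lkU , lkV) with length U ≤? length V
... | yes o≤e = begin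
  sum (encode (U , V))                                      ≡⟨ cong sum (encode-wide U V o≤e) ⟩
  sum (map (_+ suc e) U ++ conjugate V)                     ≡⟨ sum-++ (map (_+ suc e) U) (conjugate V) ⟩
  sum (map (_+ suc e) U) + sum (conjugate V)
    ≡⟨ cong₂ _+_ (sum-map-+ (suc e) U) (sum-conjugate (Linked⇒Desc lkV)) ⟩
  sum U + o * suc e + sum V                                 ≡⟨ cong (_+ sum V) (+-comm (sum U) _) ⟩
  o * suc e + sum U + sum V                                 ∎
  where
    open ≡-Reasoning
    o = length U
    e = length V
... | no o≰e = begin
  sum (encode (U , V))                                      ≡⟨ cong sum (encode-tall U V (≰⇒> o≰e)) ⟩
  sum (map (_+ o) V ++ o ∷ conjugate U)                     ≡⟨ sum-++ (map (_+ o) V) (o ∷ conjugate U) ⟩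
  sum (map (_+ o) V) + (o + sum (conjugate U))
    ≡⟨ cong₂ (λ x y → x + (o + y)) (sum-map-+ o V) (sum-conjugate (Linked⇒Desc lkU)) ⟩
  sum V + e * o + (o + sum U)                               ≡⟨ rearrange (sum V) e o (sum U) ⟩
  o * suc e + sum U + sum V                                 ∎
  where
    open ≡-Reasoning
    o = length U
    e = length V
    rearrange : ∀ v e o u → v + e * o + (o + u) ≡ o * suc e + u + v
    rearrange = solve-∀

pairs≅partitions : ∀ k → DecreasingPair ∩ HasCharge k ≅ IsPartition
pairs≅partitions k = record
  { to      = encode
  ; from    = decode k
  ; to-∈    = encode-partition ∘ proj₁
  ; from-∈  = λ (lk , pos) → proj₁ (decode-sound k _ (Linked⇒Desc lk) pos)
  ; from∘to = λ { (dp , refl) → decode-encode dp }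
  ; to∘from = λ (lk , pos) → proj₂ (decode-sound k _ (Linked⇒Desc lk) pos)
  }

EvenPartition : Pred (List ℕ) 0ℓ
EvenPartition = IsPartition ∩ All (2 ∣_)

double≡*2 : ∀ n → double n ≡ n * 2
double≡*2 n = trans (cong (n +_) (sym (+-identityʳ n))) (*-comm 2 n)

∣2⇒double⌊/2⌋ : ∀ {n} → 2 ∣ n → double ⌊ n /2⌋ ≡ n
∣2⇒double⌊/2⌋ (divides q refl) =
  trans (cong double (trans (cong ⌊_/2⌋ (sym (double≡*2 q))) (⌊double/2⌋ q))) (double≡*2 q)

⌊/2⌋-positive : ∀ {n} → 2 ∣ n → 0 < n → 0 < ⌊ n /2⌋
⌊/2⌋-positive {n} 2∣n 0<n with ⌊ n /2⌋ | ∣2⇒double⌊/2⌋ 2∣n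
... | zero  | refl = 0<n
... | suc h | _    = s≤s z≤n

partitions≅evenPartitions : IsPartition ≅ EvenPartition
partitions≅evenPartitions = record
  { to      = map double
  ; from    = map ⌊_/2⌋
  ; to-∈    = λ { {ν} (lk , pos) →
      (Linked-map⁺ (Linked.map (λ le → +-mono-≤ le le) lk) ,
       map⁺ (All.map (λ 0<x → ≤-trans 0<x (m≤m+n _ _)) pos)) ,
      map⁺ (All.universal (λ x → divides x (double≡*2 x)) ν) }
  ; from-∈  = λ ((lk , pos) , even) →
      Linked-map⁺ (Linked.map ⌊n/2⌋-mono lk) , map⁺ (All.zipWith (uncurry ⌊/2⌋-positive) (even , pos))
  ; from∘to = λ {ν} _ → trans (sym (map-∘ ν)) (map-id-local (All.universal ⌊double/2⌋ ν))
  ; to∘from = λ {μ} (_ , even) → trans (sym (map-∘ μ)) (map-id-local (All.map ∣2⇒double⌊/2⌋ even))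
  }

-- 2-cores

row-zero : ∀ xs → row xs 0 ≡ largest xs
row-zero []      = refl
row-zero (x ∷ _) = refl

RemoveDomino-row-zero : ∀ {l m} → RemoveDomino l m → row m 0 ≤ row l 0
RemoveDomino-row-zero (_ , zero  , inj₁ (m₀+2≡l₀ , _))        = subst (_ ≤_) m₀+2≡l₀ (m≤m+n _ 2)
RemoveDomino-row-zero (_ , suc i , inj₁ (_ , same))           = ≤-reflexive (same 0 (λ ()))
RemoveDomino-row-zero (_ , zero  , inj₂ (_ , m₀+1≡l₀ , _ , _)) = subst (_ ≤_) m₀+1≡l₀ (m≤m+n _ 1)
RemoveDomino-row-zero (_ , suc i , inj₂ (_ , _ , _ , same))   = ≤-reflexive (same 0 (λ ()) (λ ()))

RemoveDomino-∷ : ∀ {a l m} → IsPartition (a ∷ l) → RemoveDomino l m → RemoveDomino (a ∷ l) (a ∷ m)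
RemoveDomino-∷ {a} {l} {m} (lk , 0<a ∷ _) r@((lkm , posm) , i , cells) =
  (Linked-∷ m₀≤a lkm , 0<a ∷ posm) , suc i ,
  Sum.map (λ (m+2≡l , same) → m+2≡l , λ { zero _ → refl ; (suc k) k≢i → same k (k≢i ∘ cong suc) })
          (λ (l≡l , m+1≡l , m′+1≡l′ , same) → l≡l , m+1≡l , m′+1≡l′ ,
             λ { zero _ _ → refl ; (suc k) k≢i k≢i+1 → same k (k≢i ∘ cong suc) (k≢i+1 ∘ cong suc) })
          cells
  where
    m₀≤a : largest m ≤ a
    m₀≤a = ≤-trans (subst₂ _≤_ (row-zero m) (row-zero l) (RemoveDomino-row-zero {l} {m} r)) (Desc-largest lk)

IsStaircase : Pred (List ℕ) 0ℓ
IsStaircase κ = ∃[ k ] κ ≡ staircase k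

Shrinkable : Pred (List ℕ) 0ℓ
Shrinkable κ = ∃[ μ ] RemoveDomino κ μ × size μ < size κ

shrinkable-horizontal : ∀ {a R} → IsPartition (a ∷ R) → 2 + largest R ≤ a → Shrinkable (a ∷ R)
shrinkable-horizontal {suc (suc zero)} (_ , _ ∷ pos) (s≤s (s≤s R≤0)) rewrite Positive-largest≤0 pos R≤0 =
  [] , (([] , []) , 0 , inj₁ (refl , λ { zero 0≢0 → contradiction refl 0≢0 ; (suc k) _ → refl })) , s≤s z≤n
shrinkable-horizontal {suc (suc (suc a))} {R} (lk , _ ∷ pos) (s≤s (s≤s R≤a+1)) =
  suc a ∷ R ,
  ((Linked-∷ R≤a+1 (Linked.tail lk) , s≤s z≤n ∷ pos) , 0 ,
   inj₁ (+-comm (suc a) 2 , λ { zero 0≢0 → contradiction refl 0≢0 ; (suc k) _ → refl })) ,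
  s≤s (s≤s (+-monoˡ-≤ (sum R) (n≤1+n a)))

shrinkable-vertical : ∀ {m R} → IsPartition (suc m ∷ suc m ∷ R) → largest R ≤ m → Shrinkable (suc m ∷ suc m ∷ R)
shrinkable-vertical {zero} (_ , _ ∷ _ ∷ pos) R≤0 rewrite Positive-largest≤0 pos R≤0 =
  [] , (([] , []) , 0 , inj₂ (refl , refl , refl , λ
    { zero 0≢0 _ → contradiction refl 0≢0 ; (suc zero) _ 1≢1 → contradiction refl 1≢1 ; (suc (suc k)) _ _ → refl })) ,
  s≤s z≤n
shrinkable-vertical {suc m} {R} (lk , _ ∷ _ ∷ pos) R≤m+1 =
  suc m ∷ suc m ∷ R ,
  ((≤-refl ∷ Linked-∷ R≤m+1 (Linked.tail (Linked.tail lk)) , s≤s z≤n ∷ s≤s z≤n ∷ pos) , 0 ,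
   inj₂ (refl , +-comm (suc m) 1 , +-comm (suc m) 1 , λ
    { zero 0≢0 _ → contradiction refl 0≢0 ; (suc zero) _ 1≢1 → contradiction refl 1≢1 ; (suc (suc k)) _ _ → refl })) ,
  s≤s (+-monoʳ-≤ (suc m) (n≤1+n _))

largest-staircase : ∀ k → largest (staircase k) ≡ k
largest-staircase zero    = refl
largest-staircase (suc k) = refl

staircase-or-shrinkable-∷ : ∀ {a k} → IsPartition (a ∷ staircase k) →
                            IsStaircase (a ∷ staircase k) ⊎ Shrinkable (a ∷ staircase k)
staircase-or-shrinkable-∷ {zero}          (_ , () ∷ _)
staircase-or-shrinkable-∷ {suc zero}      {zero} _ = inj₁ (1 , refl)
staircase-or-shrinkable-∷ {suc (suc a)}   {zero} p = inj₂ (shrinkable-horizontal p (s≤s (s≤s z≤n)))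
staircase-or-shrinkable-∷ {a} {suc k} p with <-cmp a (suc (suc k))
... | tri≈ _ refl _ = inj₁ (suc (suc k) , refl)
... | tri> _ _ k+2<a = inj₂ (shrinkable-horizontal p k+2<a)
... | tri< a<k+2 _ _ with ≤-antisym (≤-pred a<k+2) (Desc-largest (proj₁ p))
...   | refl = inj₂ (shrinkable-vertical p (≤-reflexive (largest-staircase k)))

staircase-or-shrinkable : ∀ {κ} → IsPartition κ → IsStaircase κ ⊎ Shrinkable κ
staircase-or-shrinkable {[]}    _               = inj₁ (0 , refl)
staircase-or-shrinkable {a ∷ κ} p@(lk , _ ∷ pos) with staircase-or-shrinkable (Linked.tail lk , pos)
... | inj₁ (k , refl)    = staircase-or-shrinkable-∷ p
... | inj₂ (μ , r , lt) = inj₂ (a ∷ μ , RemoveDomino-∷ p r , +-monoʳ-< a lt)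

row-staircase : ∀ k i → row (staircase k) i ≡ k ∸ i
row-staircase zero    zero    = refl
row-staircase zero    (suc i) = refl
row-staircase (suc k) zero    = refl
row-staircase (suc k) (suc i) = row-staircase k i

row-antitone : ∀ {xs} → Linked _≥_ xs → ∀ i → row xs (suc i) ≤ row xs i
row-antitone []         _       = z≤n
row-antitone [-]        zero    = z≤n
row-antitone [-]        (suc i) = z≤n
row-antitone (y≤x ∷ _)  zero    = y≤x
row-antitone (_ ∷ lk)   (suc i) = row-antitone lk i

staircase-irreducible : ∀ k μ → ¬ RemoveDomino (staircase k) μ
staircase-irreducible k μ ((lk , _) , i , inj₁ (μᵢ+2≡ , same)) =
  1+n≰n (subst (_≤ row μ i) μᵢ₊₁≡ (row-antitone lk i))
  where
    μᵢ₊₁≡ : row μ (suc i) ≡ suc (row μ i)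
    μᵢ₊₁≡ = begin
      row μ (suc i)                ≡⟨ same (suc i) 1+n≢n ⟩
      row (staircase k) (suc i)    ≡⟨ row-staircase k (suc i) ⟩
      k ∸ suc i                    ≡⟨ sym (pred[m∸n]≡m∸[1+n] k i) ⟩
      ℕ.pred (k ∸ i)               ≡⟨ cong ℕ.pred (trans (sym (row-staircase k i)) (sym μᵢ+2≡)) ⟩
      ℕ.pred (row μ i + 2)         ≡⟨ cong ℕ.pred (+-comm (row μ i) 2) ⟩
      suc (row μ i)                ∎
      where open ≡-Reasoning
staircase-irreducible k μ ((lk , _) , i , inj₂ (κᵢ≡κᵢ₊₁ , μᵢ+1≡ , _ , _)) = 1+n≢n (begin
  suc (row μ i)                ≡⟨ +-comm 1 (row μ i) ⟩
  row μ i + 1                  ≡⟨ trans μᵢ+1≡ (row-staircase k i) ⟩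
  k ∸ i                        ≡⟨ trans (sym (row-staircase k i)) (trans κᵢ≡κᵢ₊₁ (row-staircase k (suc i))) ⟩
  k ∸ suc i                    ≡⟨ sym (pred[m∸n]≡m∸[1+n] k i) ⟩
  ℕ.pred (k ∸ i)               ≡⟨ cong ℕ.pred (trans (sym (row-staircase k i)) (sym μᵢ+1≡)) ⟩
  ℕ.pred (row μ i + 1)         ≡⟨ cong ℕ.pred (+-comm (row μ i) 1) ⟩
  row μ i                      ∎)
  where open ≡-Reasoning

reach-staircase : ∀ {κ} → Acc (_<_ on size) κ → IsPartition κ → ∃[ k ] Star RemoveDomino κ (staircase k)
reach-staircase (acc rs) p with staircase-or-shrinkable p
... | inj₁ (k , refl)    = k , ε
... | inj₂ (μ , r , lt) = map₂ (r ◅_) (reach-staircase (rs lt) (proj₁ r))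

Star-IsPartition : ∀ {l κ} → Star RemoveDomino l κ → IsPartition l → IsPartition κ
Star-IsPartition = fold (λ l κ → IsPartition l → IsPartition κ) (λ r f _ → f (proj₁ r)) id

core-is-staircase : ∀ {l κ} → IsPartition l → Is2CoreOf κ l → IsStaircase κ
core-is-staircase p (chain , irreducible) with staircase-or-shrinkable (Star-IsPartition chain p)
... | inj₁ st           = st
... | inj₂ (μ , r , _) = contradiction r (irreducible μ)

-- The signed odd count

oddIndicator : Parity → ℤ
oddIndicator 0ℙ = 0ℤ
oddIndicator 1ℙ = 1ℤ

signedOddCount : List ℕ → ℤ
signedOddCount []       = 0ℤ
signedOddCount (x ∷ xs) = oddIndicator (parity x) - signedOddCount xs

-- RemoveDomino is phrased through row lengths, so the invariance is proved for the first N rows of a row function.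
signedOddRows : (ℕ → ℕ) → ℕ → ℤ
signedOddRows r zero    = 0ℤ
signedOddRows r (suc N) = oddIndicator (parity (r 0)) - signedOddRows (r ∘ suc) N

x-[x-y]≡y : ∀ x y → x - (x - y) ≡ y
x-[x-y]≡y = ℤ-solve-∀

parity-+2 : ∀ n → parity (n + 2) ≡ parity n
parity-+2 n = cong parity (+-comm n 2)

signedOddRows-cong : ∀ N {r s} → (∀ i → r i ≡ s i) → signedOddRows r N ≡ signedOddRows s N
signedOddRows-cong zero    _   = refl
signedOddRows-cong (suc N) r≗s =
  cong₂ (λ a b → oddIndicator (parity a) - b) (r≗s 0) (signedOddRows-cong N (r≗s ∘ suc))

signedOddRows-empty : ∀ N → signedOddRows (row []) N ≡ 0ℤ
signedOddRows-empty zero    = refl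
signedOddRows-empty (suc N) = cong (0ℤ -_) (signedOddRows-empty N)

signedOddCount-rows : ∀ xs N → length xs ≤ N → signedOddCount xs ≡ signedOddRows (row xs) N
signedOddCount-rows []       N       _         = sym (signedOddRows-empty N)
signedOddCount-rows (x ∷ xs) (suc N) (s≤s ℓ≤N) = cong (oddIndicator (parity x) -_) (signedOddCount-rows xs N ℓ≤N)

signedOddRows-horizontal : ∀ N r s i → s i + 2 ≡ r i → (∀ k → k ≢ i → s k ≡ r k) →
                           signedOddRows r N ≡ signedOddRows s N
signedOddRows-horizontal zero    r s i       _      _    = refl
signedOddRows-horizontal (suc N) r s zero    s₀+2≡r₀ same =
  cong₂ (λ a b → oddIndicator a - b) (trans (cong parity (sym s₀+2≡r₀)) (parity-+2 (s 0)))
        (signedOddRows-cong N (λ k → sym (same (suc k) (λ ()))))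
signedOddRows-horizontal (suc N) r s (suc i) sᵢ+2≡rᵢ same =
  cong₂ (λ a b → oddIndicator (parity a) - b) (sym (same 0 (λ ())))
        (signedOddRows-horizontal N (r ∘ suc) (s ∘ suc) i sᵢ+2≡rᵢ (λ k k≢i → same (suc k) (k≢i ∘ suc-injective)))

signedOddRows-vertical : ∀ N r s i → suc i < N → r i ≡ r (suc i) → s i + 1 ≡ r i → s (suc i) + 1 ≡ r (suc i) →
                         (∀ k → k ≢ i → k ≢ suc i → s k ≡ r k) → signedOddRows r N ≡ signedOddRows s N
signedOddRows-vertical (suc (suc N)) r s zero _ r₀≡r₁ s₀+1≡r₀ s₁+1≡r₁ same = begin
  oddIndicator (parity (r 0)) - (oddIndicator (parity (r 1)) - rest r)
    ≡⟨ cong (λ a → oddIndicator (parity a) - (oddIndicator (parity (r 1)) - rest r)) r₀≡r₁ ⟩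
  oddIndicator (parity (r 1)) - (oddIndicator (parity (r 1)) - rest r)
    ≡⟨ x-[x-y]≡y (oddIndicator (parity (r 1))) (rest r) ⟩
  rest r
    ≡⟨ signedOddRows-cong N (λ k → sym (same (suc (suc k)) (λ ()) (λ ()))) ⟩
  rest s
    ≡⟨ sym (x-[x-y]≡y (oddIndicator (parity (s 1))) (rest s)) ⟩
  oddIndicator (parity (s 1)) - (oddIndicator (parity (s 1)) - rest s)
    ≡⟨ cong (λ a → oddIndicator (parity a) - (oddIndicator (parity (s 1)) - rest s)) s₁≡s₀ ⟩
  oddIndicator (parity (s 0)) - (oddIndicator (parity (s 1)) - rest s) ∎
  where
    open ≡-Reasoning
    rest : (ℕ → ℕ) → ℤ
    rest t = signedOddRows (t ∘ suc ∘ suc) N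
    s₁≡s₀ = +-cancelʳ-≡ 1 (s 1) (s 0) (trans s₁+1≡r₁ (trans (sym r₀≡r₁) (sym s₀+1≡r₀)))
signedOddRows-vertical (suc N) r s (suc i) (s≤s i+1<N) rᵢ≡rᵢ₊₁ sᵢ+1≡rᵢ sᵢ₊₁+1≡rᵢ₊₁ same =
  cong₂ (λ a b → oddIndicator (parity a) - b) (sym (same 0 (λ ()) (λ ())))
        (signedOddRows-vertical N (r ∘ suc) (s ∘ suc) i i+1<N rᵢ≡rᵢ₊₁ sᵢ+1≡rᵢ sᵢ₊₁+1≡rᵢ₊₁
          (λ k k≢i k≢i+1 → same (suc k) (k≢i ∘ suc-injective) (k≢i+1 ∘ suc-injective)))

row-positive : ∀ xs i → 0 < row xs i → i < length xs
row-positive (x ∷ xs) zero    _   = s≤s z≤n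
row-positive (x ∷ xs) (suc i) pos = s≤s (row-positive xs i pos)

RemoveDomino-signedOddCount : ∀ {l m} → RemoveDomino l m → signedOddCount l ≡ signedOddCount m
RemoveDomino-signedOddCount {l} {m} (_ , i , cells) = begin
  signedOddCount l          ≡⟨ signedOddCount-rows l N (m≤m+n _ _) ⟩
  signedOddRows (row l) N
    ≡⟨ Sum.[_,_]′ (λ (m+2≡l , same) → signedOddRows-horizontal N (row l) (row m) i m+2≡l same)
                  (λ (l≡l , m+1≡l , m′+1≡l′ , same) →
                signedOddRows-vertical N (row l) (row m) i (i+1<N m′+1≡l′) l≡l m+1≡l m′+1≡l′ same) cells ⟩
  signedOddRows (row m) N   ≡⟨ sym (signedOddCount-rows m N (m≤n+m _ _)) ⟩
  signedOddCount m          ∎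
  where
    open ≡-Reasoning
    N = length l + length m
    i+1<N : row m (suc i) + 1 ≡ row l (suc i) → suc i < N
    i+1<N m′+1≡l′ =
      ≤-trans (row-positive l (suc i) (subst (0 <_) m′+1≡l′ (m≤n+m 1 (row m (suc i))))) (m≤m+n _ _)

Star-signedOddCount : ∀ {l κ} → Star RemoveDomino l κ → signedOddCount l ≡ signedOddCount κ
Star-signedOddCount =
  fold (λ l κ → signedOddCount l ≡ signedOddCount κ) (λ {l} {m} r → trans (RemoveDomino-signedOddCount {l} {m} r)) refl

stairCount : ℕ → ℤ
stairCount k = signedOddCount (staircase k)

stairCount-odd∷ : ∀ o e →
  oddIndicator (parity (o + e)) - stairCount (charge o e) ≡ stairCount (charge (suc o) e)
stairCount-odd∷ zero    zero    = refl
stairCount-odd∷ zero    (suc e) = x-[x-y]≡y (oddIndicator (parity (suc e))) (stairCount e)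
stairCount-odd∷ (suc o) zero    rewrite +-identityʳ o = refl
stairCount-odd∷ (suc o) (suc e) rewrite +-suc o e = stairCount-odd∷ o e

stairCount-even∷ : ∀ o e →
  oddIndicator (parity (suc (o + e))) - stairCount (charge o e) ≡ stairCount (charge o (suc e))
stairCount-even∷ zero          e       = refl
stairCount-even∷ (suc zero)    zero    = refl
stairCount-even∷ (suc (suc o)) zero    rewrite +-identityʳ o =
  x-[x-y]≡y (oddIndicator (parity (suc o))) (stairCount o)
stairCount-even∷ (suc o)       (suc e) rewrite +-suc o e = stairCount-even∷ o e

parity-odd+suc : ∀ p n → parity p ≡ 1ℙ → parity (p + suc n) ≡ parity n
parity-odd+suc p n odd = begin
  parity (p + suc n)            ≡⟨ +-homo-+ p (suc n) ⟩
  parity p ℙ.+ parity (suc n)   ≡⟨ cong (ℙ._+ parity (suc n)) odd ⟩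
  parity (suc n) ℙ.⁻¹           ≡⟨ suc-homo-⁻¹ n ⟩
  parity n                      ∎
  where open ≡-Reasoning

parity-even+suc : ∀ p n → parity p ≡ 0ℙ → parity (p + suc n) ≡ parity (suc n)
parity-even+suc p n even = trans (+-homo-+ p (suc n)) (cong (ℙ._+ parity (suc n)) even)

signedOddCount-addStaircase : ∀ ps → signedOddCount (addStaircase ps) ≡ stairCount (pairCharge (halves ps))
signedOddCount-addStaircase []       = refl
signedOddCount-addStaircase (p ∷ ps) with parity p in eq
... | 1ℙ = begin
  oddIndicator (parity (p + suc (length ps))) - signedOddCount (addStaircase ps)
    ≡⟨ cong₂ (λ q c → oddIndicator q - c) (trans (parity-odd+suc p (length ps) eq) (cong parity (sym ℓ≡)))
                                         (signedOddCount-addStaircase ps) ⟩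
  oddIndicator (parity (o + e)) - stairCount (charge o e)
    ≡⟨ stairCount-odd∷ o e ⟩
  stairCount (charge (suc o) e) ∎
  where
    open ≡-Reasoning
    o = length (oddHalves ps)
    e = length (evenHalves ps)
    ℓ≡ = length-halves ps
... | 0ℙ = begin
  oddIndicator (parity (p + suc (length ps))) - signedOddCount (addStaircase ps)
    ≡⟨ cong₂ (λ q c → oddIndicator q - c) (trans (parity-even+suc p (length ps) eq) (cong (parity ∘ suc) (sym ℓ≡)))
                                         (signedOddCount-addStaircase ps) ⟩
  oddIndicator (parity (suc (o + e))) - stairCount (charge o e)
    ≡⟨ stairCount-even∷ o e ⟩
  stairCount (charge o (suc e)) ∎
  where
    open ≡-Reasoning
    o = length (oddHalves ps)
    e = length (evenHalves ps)
    ℓ≡ = length-halves ps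

stairCount-double   : ∀ m → stairCount (double m) ≡ ℤ.- ℤ.+ m
stairCount-double+1 : ∀ m → stairCount (double+1 m) ≡ ℤ.+ suc m

stairCount-double zero = refl
stairCount-double (suc m) rewrite +-suc m m | parity-double m | stairCount-double+1 m = refl

stairCount-double+1 m rewrite parity-double+1 m | stairCount-double m with m
... | zero  = refl
... | suc _ = refl

stairCount⁻¹ : ℤ → ℕ
stairCount⁻¹ (ℤ.+ zero)  = 0
stairCount⁻¹ (ℤ.+ suc n) = double+1 n
stairCount⁻¹ ℤ.-[1+ n ]  = double (suc n)

stairCount⁻¹-stairCount : ∀ k → stairCount⁻¹ (stairCount k) ≡ k
stairCount⁻¹-stairCount k with parity k in eq
... | 1ℙ rewrite sym (odd⇒double+1 k eq) | stairCount-double+1 ⌊ k /2⌋ = refl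
... | 0ℙ with ⌊ k /2⌋ | even⇒double k eq
...   | zero  | refl = refl
...   | suc h | refl rewrite stairCount-double (suc h) = refl

stairCount-stairCount⁻¹ : ∀ j → stairCount (stairCount⁻¹ j) ≡ j
stairCount-stairCount⁻¹ (ℤ.+ zero)  = refl
stairCount-stairCount⁻¹ (ℤ.+ suc n) = stairCount-double+1 n
stairCount-stairCount⁻¹ ℤ.-[1+ n ]  = stairCount-double (suc n)

stairCount≡⇒≡stairCount⁻¹ : ∀ k {j} → stairCount k ≡ j → k ≡ stairCount⁻¹ j
stairCount≡⇒≡stairCount⁻¹ k refl = sym (stairCount⁻¹-stairCount k)

double-injective : ∀ {a b} → double a ≡ double b → a ≡ b
double-injective {a} {b} eq = trans (sym (⌊double/2⌋ a)) (trans (cong ⌊_/2⌋ eq) (⌊double/2⌋ b))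

double-triangle : ∀ k → double (triangle k) ≡ k * suc k
double-triangle zero    = refl
double-triangle (suc k) = begin
  (suc k + triangle k) + (suc k + triangle k)     ≡⟨ interchange (suc k) (triangle k) (suc k) (triangle k) ⟩
  (suc k + suc k) + (triangle k + triangle k)     ≡⟨ cong (suc k + suc k +_) (double-triangle k) ⟩
  (suc k + suc k) + k * suc k                     ≡⟨ expand k ⟩
  suc k * suc (suc k)                             ∎
  where
    open ≡-Reasoning
    expand : ∀ k → suc k + suc k + k * suc k ≡ suc k * suc (suc k)
    expand = solve-∀

binom2j2≡triangle : ∀ j → binom2j2 j ≡ triangle (stairCount⁻¹ j)
binom2j2≡triangle (ℤ.+ zero)  = refl
binom2j2≡triangle (ℤ.+ suc n) = trans (abs-* (ℤ.+ suc n) (ℤ.+ suc n ℤ.+ ℤ.+ suc n - 1ℤ)) (double-injective (begin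
  double (suc n * (n + suc n))                 ≡⟨ expand n ⟩
  double+1 n * suc (double+1 n)                ≡⟨ sym (double-triangle (double+1 n)) ⟩
  double (triangle (double+1 n))               ∎))
  where
    open ≡-Reasoning
    expand : ∀ n → suc n * (n + suc n) + suc n * (n + suc n) ≡ suc (n + n) * suc (suc (n + n))
    expand = solve-∀
binom2j2≡triangle ℤ.-[1+ n ]  = trans (abs-* ℤ.-[1+ n ] (ℤ.-[1+ n ] ℤ.+ ℤ.-[1+ n ] - 1ℤ)) (double-injective (begin
  double (suc n * suc (suc (suc (n + n + 0)))) ≡⟨ expand n ⟩
  double (suc n) * suc (double (suc n))        ≡⟨ sym (double-triangle (double (suc n))) ⟩
  double (triangle (double (suc n)))           ∎))
  where
    open ≡-Reasoning
    expand : ∀ n → suc n * suc (suc (suc (n + n + 0))) + suc n * suc (suc (suc (n + n + 0)))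
                 ≡ (suc n + suc n) * suc (suc n + suc n)
    expand = solve-∀

triangle-< : ∀ {a b} → a < b → triangle a < triangle b
triangle-< {a} {suc b} (s≤s a≤b) with m≤n⇒m<n∨m≡n a≤b
... | inj₁ a<b  = ≤-trans (triangle-< a<b) (m≤n+m (triangle b) (suc b))
... | inj₂ refl = s≤s (m≤n+m (triangle a) a)

triangle-injective : ∀ {a b} → triangle a ≡ triangle b → a ≡ b
triangle-injective {a} {b} eq with <-cmp a b
... | tri< a<b _ _ = contradiction eq (<⇒≢ (triangle-< a<b))
... | tri≈ _ a≡b _ = a≡b
... | tri> _ _ b<a = contradiction (sym eq) (<⇒≢ (triangle-< b<a))

InP⇒signedOddCount : ∀ {j l} → IsPartition l → InP j l → signedOddCount l ≡ j
InP⇒signedOddCount {j} {l} p (κ , core@(chain , _) , size≡) with core-is-staircase p core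
... | k , refl = begin
  signedOddCount l              ≡⟨ Star-signedOddCount chain ⟩
  stairCount k                  ≡⟨ cong stairCount k≡ ⟩
  stairCount (stairCount⁻¹ j)   ≡⟨ stairCount-stairCount⁻¹ j ⟩
  j                             ∎
  where
    open ≡-Reasoning
    k≡ : k ≡ stairCount⁻¹ j
    k≡ = triangle-injective {k} {stairCount⁻¹ j} (trans size≡ (binom2j2≡triangle j))

signedOddCount⇒InP : ∀ {j l} → IsPartition l → signedOddCount l ≡ j → InP j l
signedOddCount⇒InP {j} {l} p refl with reach-staircase (On.wellFounded size <-wellFounded l) p
... | k , chain =
  staircase k , (chain , staircase-irreducible k) ,
  trans (cong triangle (stairCount≡⇒≡stairCount⁻¹ k (sym (Star-signedOddCount chain))))
        (sym (binom2j2≡triangle (signedOddCount l)))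

-- Distinct partitions in 𝒫ⱼ and partitions into even parts

HasSignedOddCount : ℤ → Pred (List ℕ) 0ℓ
HasSignedOddCount j l = signedOddCount l ≡ j

signedOddCount-distinct : ∀ {l} → DistinctPartition l →
                          signedOddCount l ≡ stairCount (pairCharge (halves (subStaircase l)))
signedOddCount-distinct {l} p = begin
  signedOddCount l                                   ≡⟨ cong signedOddCount (sym (from∘to distinct≅decreasing p)) ⟩
  signedOddCount (addStaircase (subStaircase l))     ≡⟨ signedOddCount-addStaircase (subStaircase l) ⟩
  stairCount (pairCharge (halves (subStaircase l)))  ∎
  where open ≡-Reasoning

distinct≅chargedPairs : ∀ j →
  DistinctPartition ∩ HasSignedOddCount j ≅ DecreasingPair ∩ HasCharge (stairCount⁻¹ j)
distinct≅chargedPairs j = restrict (decreasing≅pairs ≅-∘ distinct≅decreasing)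
  (λ p eq → stairCount≡⇒≡stairCount⁻¹ _ (trans (sym (signedOddCount-distinct p)) eq))
  (λ p eq → trans (signedOddCount-distinct p) (trans (cong stairCount eq) (stairCount-stairCount⁻¹ j)))

distinct≅evenPartitions : ∀ j → DistinctPartition ∩ HasSignedOddCount j ≅ EvenPartition
distinct≅evenPartitions j =
  partitions≅evenPartitions ≅-∘ pairs≅partitions (stairCount⁻¹ j) ≅-∘ distinct≅chargedPairs j

sum-addStaircase-mergeHalves : ∀ U V →
  sum (addStaircase (mergeHalves U V)) ≡ triangle (length U + length V) + length U + double (sum U) + double (sum V)
sum-addStaircase-mergeHalves U V = begin
  sum (addStaircase (mergeHalves U V))
    ≡⟨ sum-addStaircase (mergeHalves U V) ⟩
  sum (mergeHalves U V) + triangle (length (mergeHalves U V))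
    ≡⟨ cong₂ _+_ (sum-mergeHalves U V) (cong triangle (length-mergeHalves U V)) ⟩
  length U + double (sum U) + double (sum V) + triangle (length U + length V)
    ≡⟨ regroup (length U) (sum U) (sum V) (triangle (length U + length V)) ⟩
  triangle (length U + length V) + length U + double (sum U) + double (sum V) ∎
  where
    open ≡-Reasoning
    regroup : ∀ o u v t → o + (u + u) + (v + v) + t ≡ t + o + (u + u) + (v + v)
    regroup = solve-∀

size-distinct≅evenPartitions : ∀ j {l} → (DistinctPartition ∩ HasSignedOddCount j) l →
                               binom2j2 j + size (to (distinct≅evenPartitions j) l) ≡ size l
size-distinct≅evenPartitions j {l} p = begin
  binom2j2 j + sum (map double (encode (U , V)))
    ≡⟨ cong₂ _+_ (trans (binom2j2≡triangle j) (cong triangle (sym c≡))) (sum-map-double (encode (U , V))) ⟩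
  triangle c + double (sum (encode (U , V)))
    ≡⟨ cong (λ s → triangle c + double s) (sum-encode dp) ⟩
  triangle c + double (o * suc e + sum U + sum V)
    ≡⟨ regroup (triangle c) (o * suc e) (sum U) (sum V) ⟩
  triangle c + double (o * suc e) + double (sum U) + double (sum V)
    ≡⟨ cong (λ t → t + double (sum U) + double (sum V)) (sym (charge-triangle o e)) ⟩
  triangle (o + e) + o + double (sum U) + double (sum V)
    ≡⟨ sym (sum-addStaircase-mergeHalves U V) ⟩
  sum (addStaircase (mergeHalves U V))
    ≡⟨ cong sum (from∘to (distinct≅chargedPairs j) p) ⟩
  sum l ∎
  where
    open ≡-Reasoning
    U = oddHalves (subStaircase l)
    V = evenHalves (subStaircase l)
    o = length U
    e = length V
    c = charge o e
    dp = proj₁ (to-∈ (distinct≅chargedPairs j) p)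
    c≡ = proj₂ (to-∈ (distinct≅chargedPairs j) p)
    regroup : ∀ t x u v → t + ((x + u + v) + (x + u + v)) ≡ t + (x + x) + (u + u) + (v + v)
    regroup = solve-∀

proposition5p13 : (j : ℤ) (n : ℕ) → SameCard (LHSCoeff j n) (RHSCoeff j n)
proposition5p13 j n = sameCard (≅-resp-≐ lhs rhs (restrict (distinct≅evenPartitions j)
  (λ { p refl → size-distinct≅evenPartitions j p })
  (λ p size≡n → trans (sym (size-distinct≅evenPartitions j p)) size≡n)))
  where
    lhs : LHSCoeff j n ≐ (DistinctPartition ∩ HasSignedOddCount j) ∩ (λ l → size l ≡ n)
    lhs = (λ (ip , inP , distinct , size≡n) → ((ip , distinct) , InP⇒signedOddCount ip inP) , size≡n)
        , (λ (((ip , distinct) , count≡j) , size≡n) → ip , signedOddCount⇒InP ip count≡j , distinct , size≡n)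
    rhs : RHSCoeff j n ≐ EvenPartition ∩ (λ μ → binom2j2 j + size μ ≡ n)
    rhs = (λ (ip , even , size≡n) → (ip , even) , size≡n)
        , (λ ((ip , even) , size≡n) → ip , even , size≡n)
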